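{- Let $p$ be an odd prime with $p \equiv 3 \pmod 8$ and let $k$ be a positive integer. Then there are no positive integers $A,B,C,D$ with $\gcd(A,B,C) = p^k$ satisfying $A + B = C$ and $ABC = D^4$. -}

module Submission where

-- Dividing by the gcd gives coprime a + b = c
-- with a·b·c·p^(3k) = D⁴; coprime factors of a fourth power prime to p are
-- fourth powers, so depending on which of a, b, c the prime p divides we reach
--   x⁴ + y⁴ = z⁴ (Fermat's descent for X⁴ − Y⁴ = W²),
--   p ∣ x⁴ + y⁴ (impossible as p ≡ 3 (mod 4), by Fermat's little theorem), or
--   p^j·X⁴ + y⁴ = z⁴, i.e. by j mod 4 Fermat's equation again or
--   z⁴ = y⁴ + q·x⁴ with q = p or p³ ≡ 3 (mod 8).
-- The q-equation fails modulo 8 or 16 unless x is even and y, z are odd; then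
-- a primitive Pythagorean triple splits it into pairwise coprime factors
-- r, s, r − s, r + s, exactly one divisible by p, and each case ends in Fermat's
-- equation, the quartic descent, or a contradiction modulo 16.
-- The file develops primes, coprimality and perfect powers; congruences and sums
-- of two squares; Pythagorean triples; the quartic descent; residues modulo 16;
-- then, for a fixed prime p ≡ 3 (mod 8), the equations above and the theorem.

open import Data.Empty using (⊥; ⊥-elim)
open import Data.Fin using (toℕ; inject₁; fromℕ)
import Data.Fin as Fin
open import Data.Fin.Properties using (toℕ<n; toℕ-inject₁; toℕ-fromℕ)
open import Data.List using ([]; _∷_)
open import Data.List.Relation.Unary.All using (_∷_)
open import Data.Nat
  using (ℕ; zero; suc; _+_; _*_; _^_; _∸_; _<_; _≤_; _%_; _!; z≤n; s≤s; NonZero; >-nonZero;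
         nonTrivial⇒n>1; _<?_; _≟_)
open import Data.Nat.Combinatorics using (nCk≡n!/k![n-k]!; k![n∸k]!∣n!; nCn≡1) renaming (_C_ to _choose_)
open import Data.Nat.Divisibility
open import Data.Nat.DivMod using (_/_; m*[n/m]≡n; [m+kn]%n≡m%n; m%n<n; m≡m%n+[m/n]*n)
open import Data.Nat.GCD using (gcd; gcd[m,n]∣m; gcd[m,n]∣n; gcd-greatest; gcd[m,n]≢0)
open import Data.Nat.Induction using (<-wellFounded)
open import Data.Nat.Primality
open import Data.Nat.Primality.Factorisation using (factorise)
open import Data.Nat.Properties
open import Data.Nat.Solver using (module +-*-Solver)
open import Data.Product using (_×_; _,_; ∃-syntax; proj₁; proj₂)
open import Data.Sum using (_⊎_; inj₁; inj₂; [_,_]′)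
open import Data.Vec.Functional using (Vector; init; tail)
open import Induction.WellFounded using (Acc; acc)
open import Relation.Binary.Definitions using (tri<; tri≈; tri>)
open import Relation.Binary.PropositionalEquality
open import Relation.Nullary using (¬_; Dec; yes; no; contradiction)

import Algebra.Definitions.RawSemiring Data.Nat.+-*-rawSemiring as Semiringℕ
open import Algebra.Properties.CommutativeSemiring.Binomial +-*-commutativeSemiring
  using (theorem; binomialTerm)
open import Algebra.Properties.Monoid.Sum +-0-monoid using (sum; sum-init-last)

open +-*-Solver

prime≥2 : ∀ {p} → Prime p → 2 ≤ p
prime≥2 {p} pp = nonTrivial⇒n>1 p {{prime⇒nonTrivial pp}}

prime∤1 : ∀ {p} → Prime p → ¬ p ∣ 1
prime∤1 pp p∣1 with ∣1⇒≡1 p∣1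
... | refl = ¬prime[1] pp

prime∣prime⇒≡ : ∀ {g p} → Prime g → Prime p → g ∣ p → g ≡ p
prime∣prime⇒≡ pg pp g∣p with prime⇒irreducible pp g∣p
... | inj₁ refl = ⊥-elim (¬prime[1] pg)
... | inj₂ g≡p  = g≡p

prime∣^ : ∀ {g} b n → Prime g → g ∣ b ^ n → g ∣ b
prime∣^ b zero    pg g∣1 = ⊥-elim (prime∤1 pg g∣1)
prime∣^ b (suc n) pg g∣bbⁿ with euclidsLemma b (b ^ n) pg g∣bbⁿ
... | inj₁ g∣b  = g∣b
... | inj₂ g∣bⁿ = prime∣^ b n pg g∣bⁿ

prime∣square : ∀ {g} b → Prime g → g ∣ b * b → g ∣ b
prime∣square b pg g∣bb with euclidsLemma b b pg g∣bb
... | inj₁ g∣b = g∣b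
... | inj₂ g∣b = g∣b

primeDivisor : ∀ n → 2 ≤ n → ∃[ g ] (Prime g × g ∣ n)
primeDivisor 1 (s≤s ())
primeDivisor n@(suc (suc _)) _ with factorise n
... | record { factors = g ∷ _ ; isFactorisation = eq ; factorsPrime = pg ∷ _ } =
  g , pg , subst (g ∣_) (sym eq) (m∣m*n _)
... | record { factors = [] ; isFactorisation = () }

pos-∣ : ∀ {a d} → 0 < a → d ∣ a → 0 < d
pos-∣ {d = zero}  0<a d∣a rewrite 0∣⇒≡0 d∣a = 0<a
pos-∣ {d = suc d} _   _   = s≤s z≤n

pos-*ˡ : ∀ {a b} → 0 < a * b → 0 < a
pos-*ˡ {a} {b} 0<ab = pos-∣ 0<ab (m∣m*n b)

pos-* : ∀ {a b} → 0 < a → 0 < b → 0 < a * b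
pos-* {suc a} {suc b} _ _ = s≤s z≤n

pos-^ : ∀ {a} n → 0 < a ^ suc n → 0 < a
pos-^ {a} n = pos-*ˡ {a} {a ^ n}

^-distribʳ-* : ∀ m n k → (m * n) ^ k ≡ m ^ k * n ^ k
^-distribʳ-* m n zero    = refl
^-distribʳ-* m n (suc k) rewrite ^-distribʳ-* m n k =
  solve 4 (λ m n a b → (m :* n) :* (a :* b) := (m :* a) :* (n :* b)) refl m n (m ^ k) (n ^ k)

-- Coprimality, phrased through primes so that it combines directly with
-- Euclid's lemma: no prime divides both numbers.

NoCommonPrime : ℕ → ℕ → Set
NoCommonPrime a b = ∀ {g} → Prime g → g ∣ a → g ∣ b → ⊥

ncp-sym : ∀ {a b} → NoCommonPrime a b → NoCommonPrime b a
ncp-sym c pg g∣b g∣a = c pg g∣a g∣b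

ncp-* : ∀ {a b c} → NoCommonPrime a b → NoCommonPrime a c → NoCommonPrime a (b * c)
ncp-* {b = b} {c} cab cac pg g∣a g∣bc with euclidsLemma b c pg g∣bc
... | inj₁ g∣b = cab pg g∣a g∣b
... | inj₂ g∣c = cac pg g∣a g∣c

ncp-∣ˡ : ∀ {a b d} → d ∣ a → NoCommonPrime a b → NoCommonPrime d b
ncp-∣ˡ d∣a c pg g∣d = c pg (∣-trans g∣d d∣a)

ncp-∣ʳ : ∀ {a b d} → d ∣ b → NoCommonPrime a b → NoCommonPrime a d
ncp-∣ʳ d∣b c pg g∣a g∣d = c pg g∣a (∣-trans g∣d d∣b)

ncp-1 : ∀ {a} → NoCommonPrime a 1
ncp-1 pg _ g∣1 = prime∤1 pg g∣1

ncp-prime^ : ∀ {a p} e → Prime p → ¬ p ∣ a → NoCommonPrime a (p ^ e)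
ncp-prime^ {p = p} e pp p∤a pg g∣a g∣pᵉ with prime∣prime⇒≡ pg pp (prime∣^ p e pg g∣pᵉ)
... | refl = p∤a g∣a

prime^∣-cancel : ∀ {g M} n x → Prime g → ¬ g ∣ M → g ^ n ∣ x * M → g ^ n ∣ x
prime^∣-cancel zero    x _  _   _ = 1∣ x
prime^∣-cancel {g} {M} (suc n) x pg g∤M gⁿ⁺¹∣xM
  with euclidsLemma x M pg (∣-trans (m∣m*n (g ^ n)) gⁿ⁺¹∣xM)
... | inj₂ g∣M = ⊥-elim (g∤M g∣M)
... | inj₁ (divides x′ refl) =
  subst (_∣ x′ * g) (*-comm (g ^ n) g) (*-monoˡ-∣ g (prime^∣-cancel n x′ pg g∤M gⁿ∣x′M))
  where
  instance _ = prime⇒nonZero pg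
  gⁿ∣x′M : g ^ n ∣ x′ * M
  gⁿ∣x′M = *-cancelˡ-∣ g
    (subst (g * g ^ n ∣_) (solve 3 (λ x g m → x :* g :* m := g :* (x :* m)) refl x′ g M) gⁿ⁺¹∣xM)

-- If a * M = K * c^(n+1) and a shares no prime with M or K,
-- then a is itself an (n+1)-th power: every prime g of a divides c, so
-- g^(n+1) divides a, and we descend to a / g^(n+1).
coprimeFactorIsPower : ∀ n a M K c → 0 < a → a * M ≡ K * c ^ suc n →
  NoCommonPrime a M → NoCommonPrime a K → ∃[ d ] a ≡ d ^ suc n
coprimeFactorIsPower n a = go a (<-wellFounded a)
  where
  go : ∀ a → Acc _<_ a → ∀ M K c → 0 < a → a * M ≡ K * c ^ suc n →
       NoCommonPrime a M → NoCommonPrime a K → ∃[ d ] a ≡ d ^ suc n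
  go 1 _ _ _ _ _ _ _ _ = 1 , sym (^-zeroˡ (suc n))
  go a@(suc (suc _)) (acc rec) M K c 0<a eq cM cK
    with primeDivisor a (s≤s (s≤s z≤n))
  ... | g , pg , g∣a = descend g∣c
    where
    instance _ = prime⇒nonZero pg
    g∣c : g ∣ c
    g∣c with euclidsLemma K (c ^ suc n) pg (subst (g ∣_) eq (∣m⇒∣m*n M g∣a))
    ... | inj₁ g∣K  = ⊥-elim (cK pg g∣a g∣K)
    ... | inj₂ g∣cⁿ = prime∣^ c (suc n) pg g∣cⁿ
    descend : g ∣ c → ∃[ d ] a ≡ d ^ suc n
    descend (divides c′ refl) with prime^∣-cancel (suc n) a pg (cM pg g∣a) gᵏ∣aM
      where
      gᵏ∣aM : g ^ suc n ∣ a * M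
      gᵏ∣aM = subst (g ^ suc n ∣_)
        (sym (trans eq (trans (cong (K *_) (^-distribʳ-* c′ g (suc n))) (sym (*-assoc K _ _)))))
        (n∣m*n (K * c′ ^ suc n))
    ... | divides a′ a≡a′gᵏ with go a′ (rec a′<a) M K c′ 0<a′ eq′ (ncp-∣ˡ a′∣a cM) (ncp-∣ˡ a′∣a cK)
      where
      instance _ = m^n≢0 g (suc n)
      a′∣a : a′ ∣ a
      a′∣a = divides (g ^ suc n) (trans a≡a′gᵏ (*-comm a′ _))
      0<a′ : 0 < a′
      0<a′ = pos-∣ 0<a a′∣a
      a′<a : a′ < a
      a′<a = subst (a′ <_) (sym a≡a′gᵏ)
        (m<m*n a′ (g ^ suc n) {{>-nonZero 0<a′}} (≤-trans (prime≥2 pg) (m≤m*n g (g ^ n) {{m^n≢0 g n}})))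
      eq′ : a′ * M ≡ K * c′ ^ suc n
      eq′ = *-cancelʳ-≡ _ _ (g ^ suc n) (begin
        a′ * M * g ^ suc n       ≡⟨ solve 3 (λ a m x → a :* m :* x := a :* x :* m) refl a′ M (g ^ suc n) ⟩
        a′ * g ^ suc n * M       ≡⟨ cong (_* M) (sym a≡a′gᵏ) ⟩
        a * M                    ≡⟨ eq ⟩
        K * (c′ * g) ^ suc n     ≡⟨ cong (K *_) (^-distribʳ-* c′ g (suc n)) ⟩
        K * (c′ ^ suc n * g ^ suc n) ≡⟨ sym (*-assoc K _ _) ⟩
        K * c′ ^ suc n * g ^ suc n ∎)
        where open ≡-Reasoning
    ... | d , a′≡dᵏ = d * g , (begin
      a                       ≡⟨ a≡a′gᵏ ⟩
      a′ * g ^ suc n          ≡⟨ cong (_* g ^ suc n) a′≡dᵏ ⟩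
      d ^ suc n * g ^ suc n   ≡⟨ sym (^-distribʳ-* d g (suc n)) ⟩
      (d * g) ^ suc n         ∎)
      where open ≡-Reasoning

coprimeFactorIsPrimePowerTimesPower : ∀ n e a M c g → Prime g → 0 < a →
  a * M ≡ g ^ e * c ^ suc n → NoCommonPrime a M → ¬ g ∣ M → ∃[ d ] a ≡ g ^ e * d ^ suc n
coprimeFactorIsPrimePowerTimesPower n e a M c g pg 0<a eq cM g∤M
  with prime^∣-cancel e a pg g∤M (subst (g ^ e ∣_) (sym eq) (m∣m*n (c ^ suc n)))
... | divides a′ a≡a′gᵉ
  with coprimeFactorIsPower n a′ M 1 c (pos-∣ 0<a a′∣a) eq′ (ncp-∣ˡ a′∣a cM) ncp-1
  where
  instance _ = m^n≢0 g e {{prime⇒nonZero pg}}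
  a′∣a : a′ ∣ a
  a′∣a = divides (g ^ e) (trans a≡a′gᵉ (*-comm a′ _))
  eq′ : a′ * M ≡ 1 * c ^ suc n
  eq′ = *-cancelˡ-≡ _ _ (g ^ e) (begin
    g ^ e * (a′ * M)  ≡⟨ solve 3 (λ a x m → x :* (a :* m) := a :* x :* m) refl a′ (g ^ e) M ⟩
    a′ * g ^ e * M    ≡⟨ cong (_* M) (sym a≡a′gᵉ) ⟩
    a * M             ≡⟨ eq ⟩
    g ^ e * c ^ suc n ≡⟨ cong (g ^ e *_) (sym (*-identityˡ _)) ⟩
    g ^ e * (1 * c ^ suc n) ∎)
    where open ≡-Reasoning
... | d , a′≡dᵏ = d , trans a≡a′gᵉ (trans (*-comm a′ (g ^ e)) (cong (g ^ e *_) a′≡dᵏ))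

splitPrimePower : ∀ p a → Prime p → 0 < a → ∃[ j ] ∃[ a′ ] (a ≡ p ^ j * a′ × ¬ p ∣ a′)
splitPrimePower p a pp = go a (<-wellFounded a)
  where
  instance _ = prime⇒nonZero pp
  go : ∀ a → Acc _<_ a → 0 < a → ∃[ j ] ∃[ a′ ] (a ≡ p ^ j * a′ × ¬ p ∣ a′)
  go a (acc rec) 0<a with p ∣? a
  ... | no p∤a = 0 , a , sym (+-identityʳ a) , p∤a
  ... | yes (divides a₁ refl) with go a₁ (rec a₁<a) 0<a₁
    where
    0<a₁ : 0 < a₁
    0<a₁ = pos-*ˡ 0<a
    a₁<a : a₁ < a₁ * p
    a₁<a = m<m*n a₁ p {{>-nonZero 0<a₁}} (prime≥2 pp)
  ... | j , a′ , a₁≡pʲa′ , p∤a′ = suc j , a′ , (begin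
    a₁ * p            ≡⟨ cong (_* p) a₁≡pʲa′ ⟩
    p ^ j * a′ * p    ≡⟨ solve 3 (λ x a p → x :* a :* p := p :* x :* a) refl (p ^ j) a′ p ⟩
    p * p ^ j * a′    ∎) , p∤a′
    where open ≡-Reasoning

Odd : ℕ → Set
Odd n = ∃[ k ] n ≡ 1 + k * 2

parity : ∀ n → 2 ∣ n ⊎ Odd n
parity zero = inj₁ (divides 0 refl)
parity (suc n) with parity n
... | inj₁ (divides k n≡2k) = inj₂ (k , cong suc n≡2k)
... | inj₂ (k , n≡1+2k)     = inj₁ (divides (suc k) (cong suc n≡1+2k))

odd⇒¬even : ∀ {n} → Odd n → ¬ 2 ∣ n
odd⇒¬even (a , e₁) (divides b e₂) = odd≢even a b (trans (sym e₁) e₂)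
  where
  odd≢even : ∀ a b → 1 + a * 2 ≢ b * 2
  odd≢even zero    zero    ()
  odd≢even zero    (suc b) ()
  odd≢even (suc a) zero    ()
  odd≢even (suc a) (suc b) e = odd≢even a b (suc-injective (suc-injective e))

odd+odd : ∀ {a b} → Odd a → Odd b → 2 ∣ a + b
odd+odd (k , refl) (l , refl) =
  divides (1 + k + l) (solve 2 (λ k l → con 1 :+ k :* con 2 :+ (con 1 :+ l :* con 2) := (con 1 :+ k :+ l) :* con 2) refl k l)

odd+even : ∀ {a b} → Odd a → 2 ∣ b → Odd (a + b)
odd+even (k , refl) (divides l refl) =
  k + l , solve 2 (λ k l → con 1 :+ k :* con 2 :+ l :* con 2 := con 1 :+ (k :+ l) :* con 2) refl k l

odd*odd : ∀ {a b} → Odd a → Odd b → Odd (a * b)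
odd*odd (k , refl) (l , refl) = k + l + k * l * 2 ,
  solve 2 (λ k l → (con 1 :+ k :* con 2) :* (con 1 :+ l :* con 2) := con 1 :+ (k :+ l :+ k :* l :* con 2) :* con 2) refl k l

-- The power and multiple of the library's semiring algebra are the usual ones
-- on ℕ; needed to use its binomial theorem.
^ₛ≡^ : ∀ x n → x Semiringℕ.^ n ≡ x ^ n
^ₛ≡^ x zero    = refl
^ₛ≡^ x (suc n) = cong (x *_) (^ₛ≡^ x n)

×≡* : ∀ n x → n Semiringℕ.× x ≡ n * x
×≡* zero    x = refl
×≡* (suc n) x = cong (x +_) (×≡* n x)

prime∤! : ∀ {p} m → Prime p → m < p → ¬ p ∣ m !
prime∤! zero    pp _   p∣1 = prime∤1 pp p∣1
prime∤! (suc m) pp m<p p∣m! with euclidsLemma (suc m) (m !) pp p∣m!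
... | inj₁ p∣m+1 = <⇒≱ m<p (∣⇒≤ p∣m+1)
... | inj₂ p∣m!  = prime∤! m pp (<-trans (n<1+n m) m<p) p∣m!

prime∣choose : ∀ {p} → Prime p → ∀ k → 0 < k → k < p → p ∣ p choose k
prime∣choose {p@(suc n)} pp k 0<k k<p with euclidsLemma (k ! * (p ∸ k) !) (p choose k) pp p∣product
  where
  instance _ = k !* (p ∸ k) !≢0
  k≤p : k ≤ p
  k≤p = <⇒≤ k<p
  p∣product : p ∣ k ! * (p ∸ k) ! * (p choose k)
  p∣product = subst (p ∣_) (sym (begin
    k ! * (p ∸ k) ! * (p choose k)               ≡⟨ cong (k ! * (p ∸ k) ! *_) (nCk≡n!/k![n-k]! k≤p) ⟩
    k ! * (p ∸ k) ! * (p ! / (k ! * (p ∸ k) !))  ≡⟨ m*[n/m]≡n (k![n∸k]!∣n! k≤p) ⟩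
    p !                                          ∎)) (m∣m*n (n !))
    where open ≡-Reasoning
... | inj₂ p∣C = p∣C
... | inj₁ p∣k!r! with euclidsLemma (k !) ((p ∸ k) !) pp p∣k!r!
...   | inj₁ p∣k! = ⊥-elim (prime∤! k pp k<p p∣k!)
...   | inj₂ p∣r! = ⊥-elim (prime∤! (p ∸ k) pp (∸-monoʳ-< 0<k (<⇒≤ k<p)) p∣r!)

∣-sum : ∀ {d n} (t : Vector ℕ n) → (∀ i → d ∣ t i) → d ∣ sum t
∣-sum {n = zero}  t _ = _ ∣0
∣-sum {n = suc n} t d∣t = ∣m∣n⇒∣m+n (d∣t Fin.zero) (∣-sum (tail t) (λ i → d∣t (Fin.suc i)))

-- The "freshman's dream": (1 + a)^p ≡ 1 + a^p modulo the prime p.  In the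
-- binomial expansion the first and last terms are 1 and a^p, and p divides
-- every other term.
freshman : ∀ {p} → Prime p → ∀ a → ∃[ t ] (1 + a) ^ p ≡ 1 + a ^ p + t * p
freshman {p@(suc n)} pp a = t , (begin
  (1 + a) ^ p                                       ≡⟨ cong (_^ p) (+-comm 1 a) ⟩
  (a + 1) ^ p                                       ≡⟨ sym (^ₛ≡^ (a + 1) p) ⟩
  (a + 1) Semiringℕ.^ p                             ≡⟨ theorem p a 1 ⟩
  term Fin.zero + sum (tail term)                   ≡⟨ cong (term Fin.zero +_) (sum-init-last (tail term)) ⟩
  term Fin.zero + (sum (init (tail term)) + term (fromℕ p))
    ≡⟨ cong₂ (λ x y → x + (sum (init (tail term)) + y)) (term≡coefficient Fin.zero) (term≡coefficient (fromℕ p)) ⟩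
  coefficient 0 + (sum (init (tail term)) + coefficient (toℕ (fromℕ p)))
    ≡⟨ cong₂ (λ x y → coefficient 0 + (x + coefficient y)) inner≡tp (toℕ-fromℕ p) ⟩
  1 * 1 + (t * p + (p choose p) * a ^ p)                   ≡⟨ cong (λ x → 1 * 1 + (t * p + x * a ^ p)) (nCn≡1 p) ⟩
  1 * 1 + (t * p + 1 * a ^ p)                       ≡⟨ solve 2 (λ t x → con 1 :* con 1 :+ (t :+ con 1 :* x) := con 1 :+ x :+ t) refl (t * p) (a ^ p) ⟩
  1 + a ^ p + t * p ∎)
  where
  open ≡-Reasoning
  term : Vector ℕ (suc p)
  term = binomialTerm a 1 p
  coefficient : ℕ → ℕ
  coefficient k = (p choose k) * a ^ k
  term≡coefficient : ∀ i → term i ≡ coefficient (toℕ i)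
  term≡coefficient i = begin
    (p choose k) Semiringℕ.× (a Semiringℕ.^ k * 1 Semiringℕ.^ (p ∸ k))
      ≡⟨ ×≡* (p choose k) _ ⟩
    (p choose k) * (a Semiringℕ.^ k * 1 Semiringℕ.^ (p ∸ k))
      ≡⟨ cong₂ (λ x y → (p choose k) * (x * y)) (^ₛ≡^ a k) (trans (^ₛ≡^ 1 (p ∸ k)) (^-zeroˡ (p ∸ k))) ⟩
    (p choose k) * (a ^ k * 1)
      ≡⟨ cong ((p choose k) *_) (*-identityʳ (a ^ k)) ⟩
    (p choose k) * a ^ k ∎
    where
    open ≡-Reasoning
    k : ℕ
    k = toℕ i
  p∣inner : ∀ i → p ∣ init (tail term) i
  p∣inner i = subst (p ∣_) (sym (term≡coefficient (Fin.suc (inject₁ i))))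
    (∣m⇒∣m*n (a ^ k) (prime∣choose pp k (s≤s z≤n) (s≤s (subst (_< n) (sym (toℕ-inject₁ i)) (toℕ<n i)))))
    where k = suc (toℕ (inject₁ i))
  open _∣_ (∣-sum (init (tail term)) p∣inner) renaming (quotient to t; equality to inner≡tp)

-- Congruence modulo m on ℕ, witnessed without subtraction.

infix 4 _≋_mod_
_≋_mod_ : ℕ → ℕ → ℕ → Set
x ≋ y mod m = ∃[ t ] ∃[ u ] x + t * m ≡ y + u * m

mod-refl : ∀ {m x} → x ≋ x mod m
mod-refl = 0 , 0 , refl

mod-sym : ∀ {m x y} → x ≋ y mod m → y ≋ x mod m
mod-sym (t , u , e) = u , t , sym e

mod-trans : ∀ {m x y z} → x ≋ y mod m → y ≋ z mod m → x ≋ z mod m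
mod-trans {m} {x} {y} {z} (t , u , e₁) (t′ , u′ , e₂) = t + t′ , u + u′ , (begin
  x + (t + t′) * m       ≡⟨ solve 4 (λ x t t′ m → x :+ (t :+ t′) :* m := (x :+ t :* m) :+ t′ :* m) refl x t t′ m ⟩
  (x + t * m) + t′ * m   ≡⟨ cong (_+ t′ * m) e₁ ⟩
  (y + u * m) + t′ * m   ≡⟨ solve 4 (λ y u t′ m → (y :+ u :* m) :+ t′ :* m := (y :+ t′ :* m) :+ u :* m) refl y u t′ m ⟩
  (y + t′ * m) + u * m   ≡⟨ cong (_+ u * m) e₂ ⟩
  (z + u′ * m) + u * m   ≡⟨ solve 4 (λ z u′ u m → (z :+ u′ :* m) :+ u :* m := z :+ (u :+ u′) :* m) refl z u′ u m ⟩
  z + (u + u′) * m       ∎)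
  where open ≡-Reasoning

mod-+ : ∀ {m x y x′ y′} → x ≋ y mod m → x′ ≋ y′ mod m → x + x′ ≋ y + y′ mod m
mod-+ {m} {x} {y} {x′} {y′} (t , u , e₁) (t′ , u′ , e₂) = t + t′ , u + u′ , (begin
  x + x′ + (t + t′) * m          ≡⟨ solve 5 (λ x x′ t t′ m → x :+ x′ :+ (t :+ t′) :* m := (x :+ t :* m) :+ (x′ :+ t′ :* m)) refl x x′ t t′ m ⟩
  (x + t * m) + (x′ + t′ * m)    ≡⟨ cong₂ _+_ e₁ e₂ ⟩
  (y + u * m) + (y′ + u′ * m)    ≡⟨ solve 5 (λ y y′ u u′ m → (y :+ u :* m) :+ (y′ :+ u′ :* m) := y :+ y′ :+ (u :+ u′) :* m) refl y y′ u u′ m ⟩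
  y + y′ + (u + u′) * m          ∎)
  where open ≡-Reasoning

∣⇒≋0 : ∀ {m x} → m ∣ x → x ≋ 0 mod m
∣⇒≋0 (divides q e) = 0 , q , trans (+-identityʳ _) e

≋0⇒∣ : ∀ {m x} → x ≋ 0 mod m → m ∣ x
≋0⇒∣ {m} {x} (t , u , e) =
  ∣m+n∣m⇒∣n (subst (m ∣_) (trans (sym e) (+-comm x (t * m))) (n∣m*n u)) (n∣m*n t)

mod-cancel : ∀ {p a x y} → Prime p → ¬ p ∣ a → a * x ≋ a * y mod p → x ≋ y mod p
mod-cancel {p} {a} {x} {y} pp p∤a (t , u , e) =
  [ (λ x≤y → cancel≤ x≤y t u e) , (λ y≤x → mod-sym (cancel≤ y≤x u t (sym e))) ]′ (≤-total x y)
  where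
  -- x ≤ y: write y = x + d; then p ∣ a·d, hence p ∣ d.
  cancel≤ : ∀ {x y} → x ≤ y → ∀ t u → a * x + t * p ≡ a * y + u * p → x ≋ y mod p
  cancel≤ {x} {y} x≤y t u e with euclidsLemma a (y ∸ x) pp p∣ad
    where
    p∣ad : p ∣ a * (y ∸ x)
    p∣ad = ∣m+n∣m⇒∣n (subst (p ∣_) (+-cancelˡ-≡ (a * x) _ _ (begin
      a * x + t * p               ≡⟨ e ⟩
      a * y + u * p               ≡⟨ cong (λ z → a * z + u * p) (sym (m+[n∸m]≡n x≤y)) ⟩
      a * (x + (y ∸ x)) + u * p   ≡⟨ solve 4 (λ a x d u → a :* (x :+ d) :+ u := a :* x :+ (u :+ a :* d)) refl a x (y ∸ x) (u * p) ⟩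
      a * x + (u * p + a * (y ∸ x)) ∎)) (n∣m*n t)) (n∣m*n u)
      where open ≡-Reasoning
  ... | inj₁ p∣a = ⊥-elim (p∤a p∣a)
  ... | inj₂ (divides w d≡wp) = w , 0 , trans (cong (x +_) (sym d≡wp)) (trans (m+[n∸m]≡n x≤y) (sym (+-identityʳ y)))

-- Fermat's little theorem, by induction on a using the freshman's dream.
fermatLittle : ∀ {p} → Prime p → ∀ a → a ^ p ≋ a mod p
fermatLittle {suc n} pp zero    = mod-refl
fermatLittle {p}     pp (suc a) with freshman pp a
... | t , expansion =
  mod-trans (0 , t , trans (+-identityʳ _) expansion) (mod-+ (mod-refl {x = 1}) (fermatLittle pp a))

∣-oddPowerSum : ∀ {d} X Y t → d ∣ X + Y → d ∣ X ^ (1 + t * 2) + Y ^ (1 + t * 2)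
∣-oddPowerSum {d} X Y zero    d∣X+Y = subst (d ∣_) (cong₂ _+_ (sym (*-identityʳ X)) (sym (*-identityʳ Y))) d∣X+Y
∣-oddPowerSum {d} X Y (suc t) d∣X+Y = ∣m+n∣m⇒∣n (subst (d ∣_) factorisation (∣m⇒∣m*n (X * A + Y * B) d∣X+Y))
                                                (∣n⇒∣m*n (X * Y) (∣-oddPowerSum X Y t d∣X+Y))
  where
  A : ℕ
  A = X ^ (1 + t * 2)
  B : ℕ
  B = Y ^ (1 + t * 2)
  factorisation : (X + Y) * (X * A + Y * B) ≡ X * Y * (A + B) + (X * (X * A) + Y * (Y * B))
  factorisation = solve 4 (λ x y a b → (x :+ y) :* (x :* a :+ y :* b) := x :* y :* (a :+ b) :+ (x :* (x :* a) :+ y :* (y :* b))) refl X Y A B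

square^ : ∀ a m → (a * a) ^ m ≡ a ^ (m + m)
square^ a zero    = refl
square^ a (suc m) rewrite +-suc m m | square^ a m = *-assoc a a _

-- Otherwise p ∤ b as well,
-- and with p − 1 = 2(2t + 1) Fermat's little theorem gives
-- 2 ≡ a^(p−1) + b^(p−1) = (a²)^(2t+1) + (b²)^(2t+1) ≡ 0 (mod p).
prime≡3mod4∣sumOfSquares : ∀ {p} t a b → Prime p → p ≡ 3 + t * 4 → p ∣ a * a + b * b → p ∣ a
prime≡3mod4∣sumOfSquares {p} t a b pp p≡3+4t p∣a²+b² with p ∣? a
... | yes p∣a = p∣a
... | no  p∤a = ⊥-elim (<⇒≱ (subst (2 <_) (sym p≡3+4t) (s≤s (s≤s (s≤s z≤n)))) (∣⇒≤ (≋0⇒∣ two≡0)))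
  where
  p∤b : ¬ p ∣ b
  p∤b p∣b = p∤a (prime∣square a pp (∣m+n∣m⇒∣n (subst (p ∣_) (+-comm (a * a) (b * b)) p∣a²+b²) (∣m⇒∣m*n b p∣b)))
  m : ℕ
  m = 1 + t * 2
  p≡1+2m : p ≡ suc (m + m)
  p≡1+2m = trans p≡3+4t (solve 1 (λ t → con 3 :+ t :* con 4 := con 1 :+ ((con 1 :+ t :* con 2) :+ (con 1 :+ t :* con 2))) refl t)
  c^[p-1]≡1 : ∀ c → ¬ p ∣ c → c ^ (m + m) ≋ 1 mod p
  c^[p-1]≡1 c p∤c = mod-cancel pp p∤c
    (subst₂ (_≋_mod p) (cong (c ^_) p≡1+2m) (sym (*-identityʳ c)) (fermatLittle pp c))
  p∣sum : p ∣ a ^ (m + m) + b ^ (m + m)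
  p∣sum = subst (p ∣_) (cong₂ _+_ (square^ a m) (square^ b m)) (∣-oddPowerSum (a * a) (b * b) t p∣a²+b²)
  two≡0 : 2 ≋ 0 mod p
  two≡0 = mod-trans (mod-sym (mod-+ (c^[p-1]≡1 a p∤a) (c^[p-1]≡1 b p∤b))) (∣⇒≋0 p∣sum)

square-cancel-< : ∀ {a b} → a * a < b * b → a < b
square-cancel-< {a} {b} a²<b² with a <? b
... | yes a<b = a<b
... | no  a≮b = ⊥-elim (<⇒≱ a²<b² (*-mono-≤ (≮⇒≥ a≮b) (≮⇒≥ a≮b)))

square-injective : ∀ {a b} → a * a ≡ b * b → a ≡ b
square-injective {a} {b} a²≡b² with <-cmp a b
... | tri< a<b _ _ = ⊥-elim (<⇒≢ (*-mono-< a<b a<b) a²≡b²)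
... | tri≈ _ a≡b _ = a≡b
... | tri> _ _ b<a = ⊥-elim (<⇒≢ (*-mono-< b<a b<a) (sym a²≡b²))

square≡^2 : ∀ x → x * x ≡ x ^ 2
square≡^2 x = cong (x *_) (sym (*-identityʳ x))

^4≡square² : ∀ x → x ^ 4 ≡ (x * x) * (x * x)
^4≡square² x = solve 1 (λ x → x :^ 4 := (x :* x) :* (x :* x)) refl x

coprimeFactorOfSquare : ∀ {a M} y → 0 < a → a * M ≡ y * y → NoCommonPrime a M → ∃[ d ] a ≡ d * d
coprimeFactorOfSquare {a} {M} y 0<a aM≡y² cM with
  coprimeFactorIsPower 1 a M 1 y 0<a (trans aM≡y² (trans (square≡^2 y) (sym (*-identityˡ _)))) cM ncp-1
... | d , a≡d² = d , trans a≡d² (sym (square≡^2 d))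

odd-square⇒odd : ∀ {a} → Odd (a * a) → Odd a
odd-square⇒odd {a} odd-a² with parity a
... | inj₁ 2∣a  = ⊥-elim (odd⇒¬even odd-a² (∣m⇒∣m*n a 2∣a))
... | inj₂ odd-a = odd-a

even-difference : ∀ {a b c} → Odd a → Odd c → a + b ≡ c → 2 ∣ b
even-difference {a} {b} {c} odd-a odd-c a+b≡c with parity b
... | inj₁ 2∣b   = 2∣b
... | inj₂ odd-b = ⊥-elim (odd⇒¬even odd-c (subst (2 ∣_) a+b≡c (odd+odd odd-a odd-b)))

-- An odd square plus an odd square is never a square (it is 2 mod 4).
odd²+odd²≢square : ∀ {a b} c → Odd a → Odd b → a * a + b * b ≢ c * c
odd²+odd²≢square {a} {b} c odd-a odd-b a²+b²≡c² with parity c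
... | inj₂ odd-c = odd⇒¬even (subst Odd (sym a²+b²≡c²) (odd*odd odd-c odd-c))
                             (odd+odd (odd*odd odd-a odd-a) (odd*odd odd-b odd-b))
... | inj₁ (divides m refl) = twoMod4 odd-a odd-b a²+b²≡c²
  where
  twoMod4 : ∀ {a b} → Odd a → Odd b → a * a + b * b ≢ m * 2 * (m * 2)
  twoMod4 (k , refl) (l , refl) e = odd⇒¬even (k + k * k + l + l * l , refl) (divides (m * m) (*-cancelʳ-≡ _ _ 2 (begin
    (1 + (k + k * k + l + l * l) * 2) * 2
      ≡⟨ solve 2 (λ k l → (con 1 :+ (k :+ k :* k :+ l :+ l :* l) :* con 2) :* con 2
                        := (con 1 :+ k :* con 2) :* (con 1 :+ k :* con 2) :+ (con 1 :+ l :* con 2) :* (con 1 :+ l :* con 2)) refl k l ⟩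
    (1 + k * 2) * (1 + k * 2) + (1 + l * 2) * (1 + l * 2)
      ≡⟨ e ⟩
    m * 2 * (m * 2)
      ≡⟨ solve 1 (λ m → m :* con 2 :* (m :* con 2) := m :* m :* con 2 :* con 2) refl m ⟩
    m * m * 2 * 2 ∎)))
    where open ≡-Reasoning

record PythagoreanParameters (a b c : ℕ) : Set where
  field
    r s      : ℕ
    oddLeg   : a + s * s ≡ r * r
    evenLeg  : b ≡ 2 * r * s
    hypot    : c ≡ r * r + s * s
    coprime  : NoCommonPrime r s
    s>0      : 0 < s

pythagorean : ∀ a b c → 0 < a → 0 < b → a * a + b * b ≡ c * c → NoCommonPrime a b → Odd a →
              PythagoreanParameters a b c
pythagorean a b c 0<a 0<b a²+b²≡c² cab odd-a = parametrise 2∣b 2∣c∸a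
  where
  2∣b : 2 ∣ b
  2∣b with parity b
  ... | inj₁ 2∣b   = 2∣b
  ... | inj₂ odd-b = ⊥-elim (odd²+odd²≢square c odd-a odd-b a²+b²≡c²)
  a<c : a < c
  a<c = square-cancel-< (subst (a * a <_) a²+b²≡c² (m<m+n (a * a) (pos-* 0<b 0<b)))
  a+[c∸a]≡c : a + (c ∸ a) ≡ c
  a+[c∸a]≡c = m+[n∸m]≡n (<⇒≤ a<c)
  odd-c : Odd c
  odd-c = odd-square⇒odd (subst Odd a²+b²≡c² (odd+even (odd*odd odd-a odd-a) (∣m⇒∣m*n b 2∣b)))
  2∣c∸a : 2 ∣ c ∸ a
  2∣c∸a = even-difference odd-a odd-c a+[c∸a]≡c
  -- With b = 2b′ and c = a + 2t we get b′² = t (a + t), with t and a + t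
  -- coprime, so both are squares.
  parametrise : 2 ∣ b → 2 ∣ c ∸ a → PythagoreanParameters a b c
  parametrise (divides b′ b≡2b′) (divides t c∸a≡2t) = record
    { r = r ; s = s ; oddLeg = a+s²≡r² ; evenLeg = b≡2rs ; hypot = c≡r²+s²
    ; coprime = crs ; s>0 = pos-*ˡ (subst (0 <_) t≡s² 0<t) }
    where
    c≡a+2t : c ≡ a + t * 2
    c≡a+2t = trans (sym a+[c∸a]≡c) (cong (a +_) c∸a≡2t)
    b′²≡t[a+t] : b′ * b′ ≡ t * (a + t)
    b′²≡t[a+t] = *-cancelʳ-≡ _ _ 4 (+-cancelˡ-≡ (a * a) _ _ (begin
      a * a + b′ * b′ * 4         ≡⟨ solve 2 (λ a b → a :* a :+ b :* b :* con 4 := a :* a :+ b :* con 2 :* (b :* con 2)) refl a b′ ⟩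
      a * a + b′ * 2 * (b′ * 2)   ≡⟨ cong (λ z → a * a + z * z) (sym b≡2b′) ⟩
      a * a + b * b               ≡⟨ a²+b²≡c² ⟩
      c * c                       ≡⟨ cong (λ z → z * z) c≡a+2t ⟩
      (a + t * 2) * (a + t * 2)   ≡⟨ solve 2 (λ a t → (a :+ t :* con 2) :* (a :+ t :* con 2) := a :* a :+ t :* (a :+ t) :* con 4) refl a t ⟩
      a * a + t * (a + t) * 4     ∎))
      where open ≡-Reasoning
    0<t : 0 < t
    0<t = pos-*ˡ (subst (0 <_) b′²≡t[a+t] (pos-* 0<b′ 0<b′))
      where
      0<b′ : 0 < b′
      0<b′ = pos-*ˡ (subst (0 <_) b≡2b′ 0<b)
    ct : NoCommonPrime t (a + t)
    ct {g} pg g∣t g∣a+t = cab pg g∣a g∣b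
      where
      g∣a : g ∣ a
      g∣a = ∣m+n∣m⇒∣n (subst (g ∣_) (+-comm a t) g∣a+t) g∣t
      g∣b : g ∣ b
      g∣b = subst (g ∣_) (sym b≡2b′)
              (∣m⇒∣m*n 2 (prime∣square b′ pg (subst (g ∣_) (sym b′²≡t[a+t]) (∣m⇒∣m*n (a + t) g∣t))))
    square-t : ∃[ d ] t ≡ d * d
    square-t = coprimeFactorOfSquare b′ 0<t (sym b′²≡t[a+t]) ct
    square-a+t : ∃[ d ] a + t ≡ d * d
    square-a+t = coprimeFactorOfSquare b′ (≤-trans 0<a (m≤m+n a t))
                   (trans (*-comm (a + t) t) (sym b′²≡t[a+t])) (ncp-sym ct)
    s : ℕ
    s = proj₁ square-t
    r : ℕ
    r = proj₁ square-a+t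
    t≡s² : t ≡ s * s
    t≡s² = proj₂ square-t
    a+s²≡r² : a + s * s ≡ r * r
    a+s²≡r² = trans (cong (a +_) (sym t≡s²)) (proj₂ square-a+t)
    b≡2rs : b ≡ 2 * r * s
    b≡2rs = trans b≡2b′ (trans (cong (_* 2) b′≡rs) (solve 2 (λ r s → r :* s :* con 2 := con 2 :* r :* s) refl r s))
      where
      b′≡rs : b′ ≡ r * s
      b′≡rs = square-injective (trans b′²≡t[a+t] (trans (cong₂ _*_ t≡s² (proj₂ square-a+t))
                (solve 2 (λ s r → s :* s :* (r :* r) := r :* s :* (r :* s)) refl s r)))
    c≡r²+s² : c ≡ r * r + s * s
    c≡r²+s² = trans c≡a+2t (trans (cong (λ z → a + z * 2) t≡s²)
                (trans (solve 2 (λ a s → a :+ s :* s :* con 2 := (a :+ s :* s) :+ s :* s) refl a s) (cong (_+ s * s) a+s²≡r²)))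
    crs : NoCommonPrime r s
    crs {g} pg g∣r g∣s = cab pg g∣a g∣b
      where
      g∣a : g ∣ a
      g∣a = ∣m+n∣m⇒∣n (subst (g ∣_) (trans (sym a+s²≡r²) (+-comm a (s * s))) (∣m⇒∣m*n r g∣r)) (∣m⇒∣m*n s g∣s)
      g∣b : g ∣ b
      g∣b = subst (g ∣_) (sym b≡2rs) (∣n⇒∣m*n (2 * r) g∣s)

oppositeParity : ∀ {o r s} → Odd o → o + s * s ≡ r * r → NoCommonPrime r s →
                 (Odd r × 2 ∣ s) ⊎ (2 ∣ r × Odd s)
oppositeParity {o} {r} {s} odd-o o+s²≡r² crs with parity r | parity s
... | inj₁ 2∣r  | inj₁ 2∣s  = ⊥-elim (crs prime[2] 2∣r 2∣s)
... | inj₂ odd-r | inj₁ 2∣s  = inj₁ (odd-r , 2∣s)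
... | inj₁ 2∣r  | inj₂ odd-s = inj₂ (2∣r , odd-s)
... | inj₂ odd-r | inj₂ odd-s =
  ⊥-elim (odd⇒¬even (odd*odd odd-r odd-r) (subst (2 ∣_) o+s²≡r² (odd+odd odd-o (odd*odd odd-s odd-s))))

record OddLegSplit (o r s : ℕ) : Set where
  field
    L        : ℕ
    s+L≡r    : s + L ≡ r
    o≡L[r+s] : o ≡ L * (r + s)
    odd-L    : Odd L
    c-r-L    : NoCommonPrime r L
    c-s-L    : NoCommonPrime s L
    c-r-S    : NoCommonPrime r (r + s)
    c-s-S    : NoCommonPrime s (r + s)
    c-L-S    : NoCommonPrime L (r + s)

splitOddLeg : ∀ {o r s} → Odd o → 0 < o → o + s * s ≡ r * r → NoCommonPrime r s → OddLegSplit o r s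
splitOddLeg {o} {r} {s} odd-o 0<o o+s²≡r² crs = record
  { L = L ; s+L≡r = s+L≡r ; o≡L[r+s] = o≡L[r+s] ; odd-L = odd-L
  ; c-r-L = c-r-L ; c-s-L = c-s-L ; c-r-S = c-r-S ; c-s-S = c-s-S ; c-L-S = c-L-S }
  where
  s<r : s < r
  s<r = square-cancel-< (subst (s * s <_) o+s²≡r² (m<n+m (s * s) 0<o))
  L : ℕ
  L = r ∸ s
  s+L≡r : s + L ≡ r
  s+L≡r = m+[n∸m]≡n (<⇒≤ s<r)
  o≡L[r+s] : o ≡ L * (r + s)
  o≡L[r+s] = +-cancelʳ-≡ (s * s) _ _ (begin
    o + s * s                ≡⟨ o+s²≡r² ⟩
    r * r                    ≡⟨ cong (λ z → z * z) (sym s+L≡r) ⟩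
    (s + L) * (s + L)        ≡⟨ solve 2 (λ s L → (s :+ L) :* (s :+ L) := L :* (s :+ L :+ s) :+ s :* s) refl s L ⟩
    L * (s + L + s) + s * s  ≡⟨ cong (λ z → L * (z + s) + s * s) s+L≡r ⟩
    L * (r + s) + s * s      ∎)
    where open ≡-Reasoning
  odd-L : Odd L
  odd-L with parity L | oppositeParity odd-o o+s²≡r² crs
  ... | inj₂ odd-L | _                  = odd-L
  ... | inj₁ 2∣L  | inj₁ (odd-r , 2∣s) = ⊥-elim (odd⇒¬even odd-r (subst (2 ∣_) s+L≡r (∣m∣n⇒∣m+n 2∣s 2∣L)))
  ... | inj₁ 2∣L  | inj₂ (2∣r , odd-s) = ⊥-elim (odd⇒¬even (subst Odd s+L≡r (odd+even odd-s 2∣L)) 2∣r)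
  c-r-L : NoCommonPrime r L
  c-r-L {g} pg g∣r g∣L = crs pg g∣r (∣m+n∣m⇒∣n (subst (g ∣_) (trans (sym s+L≡r) (+-comm s L)) g∣r) g∣L)
  c-s-L : NoCommonPrime s L
  c-s-L {g} pg g∣s g∣L = crs pg (subst (g ∣_) s+L≡r (∣m∣n⇒∣m+n g∣s g∣L)) g∣s
  c-r-S : NoCommonPrime r (r + s)
  c-r-S {g} pg g∣r g∣S = crs pg g∣r (∣m+n∣m⇒∣n g∣S g∣r)
  c-s-S : NoCommonPrime s (r + s)
  c-s-S {g} pg g∣s g∣S = crs pg (∣m+n∣m⇒∣n (subst (g ∣_) (+-comm r s) g∣S) g∣s) g∣s
  -- A common prime of L and r + s = L + 2s divides 2s; it is not 2 as L is odd.
  c-L-S : NoCommonPrime L (r + s)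
  c-L-S {g} pg g∣L g∣S with euclidsLemma s 2 pg (∣m+n∣m⇒∣n (subst (g ∣_) r+s≡L+2s g∣S) g∣L)
    where
    r+s≡L+2s : r + s ≡ L + s * 2
    r+s≡L+2s = trans (cong (_+ s) (sym s+L≡r)) (solve 2 (λ s L → s :+ L :+ s := L :+ s :* con 2) refl s L)
  ... | inj₁ g∣s = crs pg (subst (g ∣_) s+L≡r (∣m∣n⇒∣m+n g∣s g∣L)) g∣s
  ... | inj₂ g∣2 with prime∣prime⇒≡ pg prime[2] g∣2
  ...   | refl = odd⇒¬even odd-L g∣L

-- Fermat's descent for X⁴ − Y⁴ = W²: every positive solution yields one with
-- a smaller X, so there is none.

record QuarticSolution (X : ℕ) : Set where
  constructor solution
  field
    Y W      : ℕ
    0<Y      : 0 < Y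
    0<W      : 0 < W
    equation : X ^ 4 ≡ Y ^ 4 + W * W

SmallerSolution : ℕ → Set
SmallerSolution X = ∃[ X′ ] (X′ < X × QuarticSolution X′)

quartic-0<X : ∀ {X} → QuarticSolution X → 0 < X
quartic-0<X (solution Y W 0<Y _ eq) =
  pos-^ 3 (subst (0 <_) (sym eq) (≤-trans (m^n>0 Y {{>-nonZero 0<Y}} 4) (m≤m+n _ _)))

prime^4∣square : ∀ {g} W → Prime g → g ^ 4 ∣ W * W → g * g ∣ W
prime^4∣square {g} W pg g⁴∣W² with prime∣square W pg (∣-trans (m∣m*n (g ^ 3)) g⁴∣W²)
... | divides W₁ refl with prime∣square W₁ pg (∣-trans (m∣m*n g) g²∣W₁²)
  where
  instance _ = m*n≢0 g g {{prime⇒nonZero pg}} {{prime⇒nonZero pg}}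
  g²∣W₁² : g * g ∣ W₁ * W₁
  g²∣W₁² = *-cancelˡ-∣ (g * g) (subst₂ _∣_ (solve 1 (λ g → g :^ 4 := (g :* g) :* (g :* g)) refl g)
             (solve 2 (λ w g → w :* g :* (w :* g) := g :* g :* (w :* w)) refl W₁ g) g⁴∣W²)
... | divides W₂ refl = divides W₂ (solve 2 (λ w g → w :* g :* g := w :* (g :* g)) refl W₂ g)

-- Case 1: a prime g divides X and Y.  Dividing X, Y by g and W by g² gives a
-- smaller solution.
descentByCommonPrime : ∀ {g} X Y W → Prime g → g ∣ X → g ∣ Y → 0 < X → 0 < Y → 0 < W →
  X ^ 4 ≡ Y ^ 4 + W * W → SmallerSolution X
descentByCommonPrime {g} .(X₁ * g) .(Y₁ * g) W pg (divides X₁ refl) (divides Y₁ refl) 0<X 0<Y 0<W eq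
  with prime^4∣square W pg g⁴∣W²
  where
  g⁴∣W² : g ^ 4 ∣ W * W
  g⁴∣W² = ∣m+n∣m⇒∣n (subst (g ^ 4 ∣_) eq (divides (X₁ ^ 4) (^-distribʳ-* X₁ g 4)))
                    (divides (Y₁ ^ 4) (^-distribʳ-* Y₁ g 4))
... | divides W₂ refl =
  X₁ , X₁<X , solution Y₁ W₂ (pos-*ˡ 0<Y) (pos-*ˡ 0<W) smallerEquation
  where
  instance _ = prime⇒nonZero pg
  X₁<X : X₁ < X₁ * g
  X₁<X = m<m*n X₁ g {{>-nonZero (pos-*ˡ 0<X)}} (prime≥2 pg)
  smallerEquation : X₁ ^ 4 ≡ Y₁ ^ 4 + W₂ * W₂
  smallerEquation = *-cancelʳ-≡ _ _ (g ^ 4) {{m^n≢0 g 4}} (begin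
    X₁ ^ 4 * g ^ 4                       ≡⟨ sym (^-distribʳ-* X₁ g 4) ⟩
    (X₁ * g) ^ 4                         ≡⟨ eq ⟩
    (Y₁ * g) ^ 4 + W₂ * (g * g) * (W₂ * (g * g))
      ≡⟨ solve 3 (λ y w g → (y :* g) :^ 4 :+ w :* (g :* g) :* (w :* (g :* g)) := (y :^ 4 :+ w :* w) :* g :^ 4) refl Y₁ W₂ g ⟩
    (Y₁ ^ 4 + W₂ * W₂) * g ^ 4           ∎)
    where open ≡-Reasoning

coprimeQuartic : ∀ {X Y W} → NoCommonPrime X Y → X ^ 4 ≡ Y ^ 4 + W * W → NoCommonPrime (Y * Y) W
coprimeQuartic {X} {Y} {W} cXY eq {g} pg g∣Y² g∣W = cXY pg g∣X g∣Y
  where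
  g∣Y : g ∣ Y
  g∣Y = prime∣square Y pg g∣Y²
  g∣X : g ∣ X
  g∣X = prime∣^ X 4 pg (subst (g ∣_) (sym eq)
          (∣m∣n⇒∣m+n (∣-trans g∣Y (divides (Y ^ 3) (*-comm Y (Y ^ 3)))) (∣m⇒∣m*n W g∣W)))

-- Case 2: X, Y coprime and Y odd.  (Y²)² + W² = (X²)² is a primitive triple
-- with odd leg Y², so Y² + s² = r² and X² = r² + s², whence
-- r⁴ = (Y² + s²)² = s⁴ + Y² (r² + s²) = s⁴ + (XY)², with r < X.
descentOddY : ∀ X Y W → NoCommonPrime X Y → Odd Y → 0 < X → 0 < Y → 0 < W →
  X ^ 4 ≡ Y ^ 4 + W * W → SmallerSolution X
descentOddY X Y W cXY odd-Y 0<X 0<Y 0<W eq =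
  r , r<X , solution s (X * Y) s>0 (pos-* 0<X 0<Y) r⁴≡s⁴+[XY]²
  where
  triple : (Y * Y) * (Y * Y) + W * W ≡ (X * X) * (X * X)
  triple = trans (cong (_+ W * W) (sym (^4≡square² Y))) (trans (sym eq) (^4≡square² X))
  open PythagoreanParameters (pythagorean (Y * Y) W (X * X) (pos-* 0<Y 0<Y) 0<W triple
                                (coprimeQuartic cXY eq) (odd*odd odd-Y odd-Y))
  r<X : r < X
  r<X = square-cancel-< (subst (r * r <_) (sym hypot) (m<m+n (r * r) (pos-* s>0 s>0)))
  r⁴≡s⁴+[XY]² : r ^ 4 ≡ s ^ 4 + X * Y * (X * Y)
  r⁴≡s⁴+[XY]² = begin
    r ^ 4                                        ≡⟨ ^4≡square² r ⟩
    r * r * (r * r)                              ≡⟨ cong (λ z → z * z) (sym oddLeg) ⟩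
    (Y * Y + s * s) * (Y * Y + s * s)
      ≡⟨ solve 2 (λ y s → (y :* y :+ s :* s) :* (y :* y :+ s :* s) := s :^ 4 :+ (y :* y :+ s :* s :+ s :* s) :* (y :* y)) refl Y s ⟩
    s ^ 4 + (Y * Y + s * s + s * s) * (Y * Y)    ≡⟨ cong (λ z → s ^ 4 + (z + s * s) * (Y * Y)) oddLeg ⟩
    s ^ 4 + (r * r + s * s) * (Y * Y)            ≡⟨ cong (λ z → s ^ 4 + z * (Y * Y)) (sym hypot) ⟩
    s ^ 4 + X * X * (Y * Y)                      ≡⟨ cong (s ^ 4 +_) (solve 2 (λ x y → x :* x :* (y :* y) := x :* y :* (x :* y)) refl X Y) ⟩
    s ^ 4 + X * Y * (X * Y)                      ∎
    where open ≡-Reasoning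

-- Writing o = g² − h², e = 2gh, X = g² + h² and L = g − h,
-- we get Y₁² = g·h·L·(g + h) with pairwise coprime factors, so g = G², h = H²,
-- L = α², g + h = β², and then G⁴ = g² = o + h² = (αβ)² + H⁴ with G < X.
descentFromLegs : ∀ o e X Y₁ → Odd o → NoCommonPrime o e → 0 < o → 0 < e →
  o * o + e * e ≡ X * X → Y₁ * Y₁ * 2 ≡ o * e → SmallerSolution X
descentFromLegs o e X Y₁ odd-o coe 0<o 0<e o²+e²≡X² 2Y₁²≡oe =
  G , G<X , solution H (α * β) 0<H (pos-* 0<α 0<β) G⁴≡H⁴+[αβ]²
  where
  open PythagoreanParameters (pythagorean o e X 0<o 0<e o²+e²≡X² coe odd-o)
    renaming (r to g; s to h; s>0 to 0<h; coprime to c-g-h)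
  open OddLegSplit (splitOddLeg odd-o 0<o oddLeg c-g-h)
  S : ℕ
  S = g + h
  Y₁²≡ghLS : Y₁ * Y₁ ≡ g * h * L * S
  Y₁²≡ghLS = *-cancelʳ-≡ _ _ 2 (begin
    Y₁ * Y₁ * 2            ≡⟨ 2Y₁²≡oe ⟩
    o * e                  ≡⟨ cong₂ _*_ o≡L[r+s] evenLeg ⟩
    L * S * (2 * g * h)    ≡⟨ solve 4 (λ g h L S → L :* S :* (con 2 :* g :* h) := g :* h :* L :* S :* con 2) refl g h L S ⟩
    g * h * L * S * 2      ∎)
    where open ≡-Reasoning
  0<g : 0 < g
  0<g = pos-*ˡ (subst (0 <_) oddLeg (≤-trans 0<o (m≤m+n o (h * h))))
  0<L : 0 < L
  0<L = pos-*ˡ (subst (0 <_) o≡L[r+s] 0<o)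
  0<S : 0 < S
  0<S = ≤-trans 0<g (m≤m+n g h)
  reorder : ∀ a b c d → g * h * L * S ≡ a * b * c * d → a * (b * c * d) ≡ Y₁ * Y₁
  reorder a b c d e = trans (solve 4 (λ a b c d → a :* (b :* c :* d) := a :* b :* c :* d) refl a b c d)
                            (trans (sym e) (sym Y₁²≡ghLS))
  square-g : ∃[ d ] g ≡ d * d
  square-g = coprimeFactorOfSquare Y₁ 0<g (reorder g h L S refl) (ncp-* (ncp-* c-g-h c-r-L) c-r-S)
  square-h : ∃[ d ] h ≡ d * d
  square-h = coprimeFactorOfSquare Y₁ 0<h
    (reorder h g L S (solve 4 (λ g h L S → g :* h :* L :* S := h :* g :* L :* S) refl g h L S))
    (ncp-* (ncp-* (ncp-sym c-g-h) c-s-L) c-s-S)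
  square-L : ∃[ d ] L ≡ d * d
  square-L = coprimeFactorOfSquare Y₁ 0<L
    (reorder L g h S (solve 4 (λ g h L S → g :* h :* L :* S := L :* g :* h :* S) refl g h L S))
    (ncp-* (ncp-* (ncp-sym c-r-L) (ncp-sym c-s-L)) c-L-S)
  square-S : ∃[ d ] S ≡ d * d
  square-S = coprimeFactorOfSquare Y₁ 0<S
    (reorder S g h L (solve 4 (λ g h L S → g :* h :* L :* S := S :* g :* h :* L) refl g h L S))
    (ncp-* (ncp-* (ncp-sym c-r-S) (ncp-sym c-s-S)) (ncp-sym c-L-S))
  G : ℕ
  G = proj₁ square-g
  H : ℕ
  H = proj₁ square-h
  α : ℕ
  α = proj₁ square-L
  β : ℕ
  β = proj₁ square-S
  g≡G² : g ≡ G * G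
  g≡G² = proj₂ square-g
  h≡H² : h ≡ H * H
  h≡H² = proj₂ square-h
  0<G : 0 < G
  0<G = pos-*ˡ (subst (0 <_) g≡G² 0<g)
  0<H : 0 < H
  0<H = pos-*ˡ (subst (0 <_) h≡H² 0<h)
  0<α : 0 < α
  0<α = pos-*ˡ (subst (0 <_) (proj₂ square-L) 0<L)
  0<β : 0 < β
  0<β = pos-*ˡ (subst (0 <_) (proj₂ square-S) 0<S)
  -- G ≤ G² = g ≤ g² < g² + h² = X.
  G<X : G < X
  G<X = ≤-<-trans (subst (G ≤_) (sym g≡G²) (m≤m*n G G {{>-nonZero 0<G}}))
          (subst (g <_) (sym hypot) (≤-<-trans (m≤m*n g g {{>-nonZero 0<g}}) (m<m+n (g * g) (pos-* 0<h 0<h))))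
  G⁴≡H⁴+[αβ]² : G ^ 4 ≡ H ^ 4 + α * β * (α * β)
  G⁴≡H⁴+[αβ]² = begin
    G ^ 4                               ≡⟨ trans (^4≡square² G) (cong (λ z → z * z) (sym g≡G²)) ⟩
    g * g                               ≡⟨ sym oddLeg ⟩
    o + h * h                           ≡⟨ cong₂ (λ x y → x + y * y) o≡L[r+s] h≡H² ⟩
    L * S + H * H * (H * H)             ≡⟨ cong₂ (λ x y → x * y + H * H * (H * H)) (proj₂ square-L) (proj₂ square-S) ⟩
    α * α * (β * β) + H * H * (H * H)
      ≡⟨ solve 3 (λ a b h → a :* a :* (b :* b) :+ h :* h :* (h :* h) := h :^ 4 :+ a :* b :* (a :* b)) refl α β H ⟩
    H ^ 4 + α * β * (α * β)             ∎
    where open ≡-Reasoning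

-- Then W is odd, and W² + (Y²)² = (X²)²
-- is a primitive triple with odd leg W: Y² = 2rs, X² = r² + s², where one of
-- r, s is odd; the core step applies to the legs r, s of r² + s² = X².
descentEvenY : ∀ X Y₁ W → NoCommonPrime X (Y₁ * 2) → 0 < Y₁ → 0 < W →
  X ^ 4 ≡ (Y₁ * 2) ^ 4 + W * W → SmallerSolution X
descentEvenY X Y₁ W cXY 0<Y₁ 0<W eq = fromParity (oppositeParity odd-W oddLeg coprime)
  where
  Y : ℕ
  Y = Y₁ * 2
  cYW : NoCommonPrime (Y * Y) W
  cYW = coprimeQuartic cXY eq
  odd-W : Odd W
  odd-W with parity W
  ... | inj₂ odd-W = odd-W
  ... | inj₁ 2∣W  = ⊥-elim (cYW prime[2] (∣m⇒∣m*n Y (n∣m*n Y₁)) 2∣W)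
  0<Y : 0 < Y
  0<Y = pos-* 0<Y₁ (s≤s z≤n)
  triple : W * W + (Y * Y) * (Y * Y) ≡ (X * X) * (X * X)
  triple = trans (+-comm (W * W) _) (trans (cong (_+ W * W) (sym (^4≡square² Y))) (trans (sym eq) (^4≡square² X)))
  open PythagoreanParameters (pythagorean W (Y * Y) (X * X) 0<W (pos-* 0<Y 0<Y) triple (ncp-sym cYW) odd-W)
  0<r : 0 < r
  0<r = pos-*ˡ (subst (0 <_) oddLeg (≤-trans 0<W (m≤m+n W (s * s))))
  2Y₁²≡rs : Y₁ * Y₁ * 2 ≡ r * s
  2Y₁²≡rs = *-cancelʳ-≡ _ _ 2 (begin
    Y₁ * Y₁ * 2 * 2      ≡⟨ solve 1 (λ y → y :* y :* con 2 :* con 2 := y :* con 2 :* (y :* con 2)) refl Y₁ ⟩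
    Y * Y                ≡⟨ evenLeg ⟩
    2 * r * s            ≡⟨ solve 2 (λ r s → con 2 :* r :* s := r :* s :* con 2) refl r s ⟩
    r * s * 2            ∎)
    where open ≡-Reasoning
  fromParity : (Odd r × 2 ∣ s) ⊎ (2 ∣ r × Odd s) → SmallerSolution X
  fromParity (inj₁ (odd-r , _)) =
    descentFromLegs r s X Y₁ odd-r coprime 0<r s>0 (sym hypot) 2Y₁²≡rs
  fromParity (inj₂ (_ , odd-s)) =
    descentFromLegs s r X Y₁ odd-s (ncp-sym coprime) s>0 0<r
      (trans (+-comm (s * s) (r * r)) (sym hypot)) (trans 2Y₁²≡rs (*-comm r s))

descentCoprime : ∀ X Y W → NoCommonPrime X Y → 0 < X → 0 < Y → 0 < W →
  X ^ 4 ≡ Y ^ 4 + W * W → SmallerSolution X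
descentCoprime X Y W cXY 0<X 0<Y 0<W eq with parity Y
... | inj₂ odd-Y             = descentOddY X Y W cXY odd-Y 0<X 0<Y 0<W eq
... | inj₁ (divides Y₁ refl) = descentEvenY X Y₁ W cXY (pos-*ˡ 0<Y) 0<W eq

descent : ∀ {X} → QuarticSolution X → SmallerSolution X
descent {X} sol@(solution Y W 0<Y 0<W eq) with gcd X Y ≟ 1
... | yes gcd≡1 = descentCoprime X Y W cXY (quartic-0<X sol) 0<Y 0<W eq
  where
  cXY : NoCommonPrime X Y
  cXY pg g∣X g∣Y = prime∤1 pg (subst (_ ∣_) gcd≡1 (gcd-greatest g∣X g∣Y))
... | no gcd≢1 = viaPrime (primeDivisor (gcd X Y) (gcd≥2 (gcd X Y) gcd≢0 gcd≢1))
  where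
  gcd≢0 : gcd X Y ≢ 0
  gcd≢0 = gcd[m,n]≢0 X Y (inj₂ (λ Y≡0 → <⇒≢ 0<Y (sym Y≡0)))
  gcd≥2 : ∀ n → n ≢ 0 → n ≢ 1 → 2 ≤ n
  gcd≥2 0             n≢0 _   = ⊥-elim (n≢0 refl)
  gcd≥2 1             _   n≢1 = ⊥-elim (n≢1 refl)
  gcd≥2 (suc (suc n)) _   _   = s≤s (s≤s z≤n)
  viaPrime : ∃[ g ] (Prime g × g ∣ gcd X Y) → SmallerSolution X
  viaPrime (g , pg , g∣gcd) = descentByCommonPrime X Y W pg (∣-trans g∣gcd (gcd[m,n]∣m X Y))
    (∣-trans g∣gcd (gcd[m,n]∣n X Y)) (quartic-0<X sol) 0<Y 0<W eq

noQuarticSolution : ∀ X → ¬ QuarticSolution X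
noQuarticSolution X = go X (<-wellFounded X)
  where
  go : ∀ X → Acc _<_ X → ¬ QuarticSolution X
  go X (acc rec) sol with descent sol
  ... | X′ , X′<X , sol′ = go X′ (rec X′<X) sol′

fermatQuartic : ∀ x y z → 0 < x → 0 < y → x ^ 4 + y ^ 4 ≢ z ^ 4
fermatQuartic x y z 0<x 0<y eq = noQuarticSolution z (solution y (x * x) 0<y (pos-* 0<x 0<x)
  (trans (sym eq) (trans (+-comm (x ^ 4) (y ^ 4)) (cong (y ^ 4 +_) (^4≡square² x)))))

-- Congruent numbers have equal remainders; for small literals this refutes
-- congruences by computation.
≋⇒%≡ : ∀ {m x y} .{{_ : NonZero m}} → x ≋ y mod m → x % m ≡ y % m
≋⇒%≡ {m} {x} {y} (t , u , e) = trans (sym ([m+kn]%n≡m%n x t m)) (trans (cong (_% m) e) ([m+kn]%n≡m%n y u m))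

mod-*ˡ : ∀ {m x y} c → x ≋ y mod m → c * x ≋ c * y mod m
mod-*ˡ {m} {x} {y} c (t , u , e) = c * t , c * u , (begin
  c * x + c * t * m    ≡⟨ solve 4 (λ c x t m → c :* x :+ c :* t :* m := c :* (x :+ t :* m)) refl c x t m ⟩
  c * (x + t * m)      ≡⟨ cong (c *_) e ⟩
  c * (y + u * m)      ≡⟨ solve 4 (λ c y u m → c :* (y :+ u :* m) := c :* y :+ c :* u :* m) refl c y u m ⟩
  c * y + c * u * m    ∎)
  where open ≡-Reasoning

mod-* : ∀ {m x y x′ y′} → x ≋ y mod m → x′ ≋ y′ mod m → x * x′ ≋ y * y′ mod m
mod-* {m} {x} {y} {x′} {y′} x≋y x′≋y′ =
  mod-trans (mod-*ˡ x x′≋y′) (subst₂ (_≋_mod m) (*-comm y′ x) (*-comm y′ y) (mod-*ˡ y′ x≋y))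

mod16⇒mod8 : ∀ {x y} → x ≋ y mod 16 → x ≋ y mod 8
mod16⇒mod8 {x} {y} (t , u , e) = t * 2 , u * 2 ,
  trans (cong (x +_) (*-assoc t 2 8)) (trans e (cong (y +_) (sym (*-assoc u 2 8))))

-- Fourth powers modulo 16: (2m)⁴ = 16m⁴, and (1 + 2k)⁴ ≡ 1 by expanding in the
-- parity of k.
evenFourthPower : ∀ {n} → 2 ∣ n → n ^ 4 ≋ 0 mod 16
evenFourthPower (divides m refl) =
  0 , m ^ 4 , solve 1 (λ m → (m :* con 2) :^ 4 :+ con 0 :* con 16 := con 0 :+ m :^ 4 :* con 16) refl m

oddFourthPower : ∀ {n} → Odd n → n ^ 4 ≋ 1 mod 16
oddFourthPower (k , refl) with parity k
... | inj₁ (divides j refl) = 0 , j + 6 * j * j + 16 * j * j * j + 16 * j * j * j * j ,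
  solve 1 (λ j → (con 1 :+ j :* con 2 :* con 2) :^ 4 :+ con 0 :* con 16
              := con 1 :+ (j :+ con 6 :* j :* j :+ con 16 :* j :* j :* j :+ con 16 :* j :* j :* j :* j) :* con 16) refl j
... | inj₂ (j , refl) = 0 , 5 + 27 * j + 54 * j * j + 48 * j * j * j + 16 * j * j * j * j ,
  solve 1 (λ j → (con 1 :+ (con 1 :+ j :* con 2) :* con 2) :^ 4 :+ con 0 :* con 16
              := con 1 :+ (con 5 :+ con 27 :* j :+ con 54 :* j :* j :+ con 48 :* j :* j :* j :+ con 16 :* j :* j :* j :* j) :* con 16) refl j

fourthPowerResidue : ∀ n → n ^ 4 ≋ 0 mod 16 ⊎ n ^ 4 ≋ 1 mod 16
fourthPowerResidue n with parity n
... | inj₁ 2∣n   = inj₁ (evenFourthPower 2∣n)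
... | inj₂ odd-n = inj₂ (oddFourthPower odd-n)

-- z⁴ = y⁴ + q·x⁴ is impossible for x odd and q ≡ 3 (mod 8): modulo 8 the
-- left side is 0 or 1 and the right side is 3 or 4.
noSolution-oddX : ∀ {q v} x y z → q ≡ 3 + v * 8 → Odd x → z ^ 4 ≢ y ^ 4 + q * x ^ 4
noSolution-oddX {q} {v} x y z q≡3+8v odd-x eq = residues (fourthPowerResidue z) (fourthPowerResidue y)
  where
  qx⁴≡3 : q * x ^ 4 ≋ 3 mod 8
  qx⁴≡3 = mod-* (0 , v , trans (+-identityʳ q) q≡3+8v) (mod16⇒mod8 (oddFourthPower odd-x))
  refute : ∀ {r₁ r₂} → r₁ % 8 ≢ (r₂ + 3) % 8 → z ^ 4 ≋ r₁ mod 16 → y ^ 4 ≋ r₂ mod 16 → ⊥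
  refute {r₁} {r₂} r₁≢r₂+3 z⁴≡r₁ y⁴≡r₂ = r₁≢r₂+3 (≋⇒%≡ (mod-trans (mod-sym (mod16⇒mod8 z⁴≡r₁))
    (subst (λ w → w ≋ r₂ + 3 mod 8) (sym eq) (mod-+ (mod16⇒mod8 y⁴≡r₂) qx⁴≡3))))
  residues : z ^ 4 ≋ 0 mod 16 ⊎ z ^ 4 ≋ 1 mod 16 → y ^ 4 ≋ 0 mod 16 ⊎ y ^ 4 ≋ 1 mod 16 → ⊥
  residues (inj₁ z⁴≡0) (inj₁ y⁴≡0) = refute (λ ()) z⁴≡0 y⁴≡0
  residues (inj₁ z⁴≡0) (inj₂ y⁴≡1) = refute (λ ()) z⁴≡0 y⁴≡1
  residues (inj₂ z⁴≡1) (inj₁ y⁴≡0) = refute (λ ()) z⁴≡1 y⁴≡0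
  residues (inj₂ z⁴≡1) (inj₂ y⁴≡1) = refute (λ ()) z⁴≡1 y⁴≡1

prime∤* : ∀ {p a b} → Prime p → ¬ p ∣ a → ¬ p ∣ b → ¬ p ∣ a * b
prime∤* {a = a} {b} pp p∤a p∤b p∣ab with euclidsLemma a b pp p∣ab
... | inj₁ p∣a = p∤a p∣a
... | inj₂ p∣b = p∤b p∣b

sumOfSquaresCoprime : ∀ {r s U} → NoCommonPrime r s → U ≡ r * r + s * s → NoCommonPrime U r
sumOfSquaresCoprime {r} {s} crs U≡r²+s² {g} pg g∣U g∣r =
  crs pg g∣r (prime∣square s pg (∣m+n∣m⇒∣n (subst (g ∣_) U≡r²+s² g∣U) (∣m⇒∣m*n r g∣r)))

fourthPower-cancel-< : ∀ {y z} → y ^ 4 < z ^ 4 → y < z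
fourthPower-cancel-< {y} {z} y⁴<z⁴ with y <? z
... | yes y<z = y<z
... | no  y≮z = ⊥-elim (<⇒≱ y⁴<z⁴ (^-monoˡ-≤ 4 (≮⇒≥ y≮z)))

odd-fourthRoot : ∀ {C} → Odd (C ^ 4) → Odd C
odd-fourthRoot {C} odd-C⁴ with parity C
... | inj₁ 2∣C   = ⊥-elim (odd⇒¬even odd-C⁴ (∣m⇒∣m*n (C ^ 3) 2∣C))
... | inj₂ odd-C = odd-C

prime∣2rs : ∀ {g r s d} → Prime g → Odd d → g ∣ d → g ∣ r * s * 2 → g ∣ r ⊎ g ∣ s
prime∣2rs {g} {r} {s} pg odd-d g∣d g∣2rs with euclidsLemma (r * s) 2 pg g∣2rs
... | inj₁ g∣rs = euclidsLemma r s pg g∣rs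
... | inj₂ g∣2 with prime∣prime⇒≡ pg prime[2] g∣2
...   | refl = ⊥-elim (odd⇒¬even odd-d g∣d)

coprimeFactorOfFourthPower : ∀ {f M} D → 0 < f → f * M ≡ D ^ 4 → NoCommonPrime f M → ∃[ F ] f ≡ F ^ 4
coprimeFactorOfFourthPower {f} {M} D 0<f eq c = coprimeFactorIsPower 3 f M 1 D 0<f (trans eq (sym (*-identityˡ _))) c ncp-1

sum-coprimeˡ : ∀ {a b c} → NoCommonPrime a b → a + b ≡ c → NoCommonPrime a c
sum-coprimeˡ {a} cab a+b≡c {g} pg g∣a g∣c = cab pg g∣a (∣m+n∣m⇒∣n (subst (g ∣_) (sym a+b≡c) g∣c) g∣a)

sum-coprimeʳ : ∀ {a b c} → NoCommonPrime a b → a + b ≡ c → NoCommonPrime b c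
sum-coprimeʳ {a} {b} cab a+b≡c = sum-coprimeˡ (ncp-sym cab) (trans (+-comm b a) a+b≡c)

module _ {p u : ℕ} (pp : Prime p) (p≡3+8u : p ≡ 3 + u * 8) where

  -- p ≡ 3 (mod 4), so p divides a sum of two squares only if it divides both.
  p∣sumOfSquares : ∀ a b → p ∣ a * a + b * b → p ∣ a
  p∣sumOfSquares a b = prime≡3mod4∣sumOfSquares (u * 2) a b pp (trans p≡3+8u (cong (3 +_) (sym (*-assoc u 2 4))))

  -- Parametrise o = r² − s²,
  -- e = 2rs, U = r² + s²; then r·s·(r − s)·(r + s)·U² = q·x⁴ with pairwise
  -- coprime factors and p ∤ U.  So p divides exactly one of r, s, r − s, r + s;
  -- that factor is q times a fourth power and the others are fourth powers:
  --   p ∣ r + s:  s + (r − s) = r reads B⁴ + C⁴ = A⁴;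
  --   p ∣ r − s:  r + s reads A⁴ + B⁴ = D⁴;
  --   p ∣ r:      (r − s) + (r + s) = 2r gives 2 ≡ 2q·A⁴ ∈ {0, 6} (mod 16);
  --   p ∣ s:      (r − s)·(r + s) = r² − s² yields (A²)⁴ = (CD)⁴ + (qB⁴)².
  module CentralLemma (k v o e U x : ℕ) (q≡3+8v : p ^ suc k ≡ 3 + v * 8) (odd-o : Odd o)
    (coe : NoCommonPrime o e) (0<o : 0 < o) (0<e : 0 < e) (o²+e²≡U² : o * o + e * e ≡ U * U)
    (oeU²≡2qx⁴ : o * e * (U * U) ≡ 2 * p ^ suc k * x ^ 4) where

    q : ℕ
    q = p ^ suc k
    open PythagoreanParameters (pythagorean o e U 0<o 0<e o²+e²≡U² coe odd-o)
    open OddLegSplit (splitOddLeg odd-o 0<o oddLeg coprime)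
    S : ℕ
    S = r + s
    odd-S : Odd S
    odd-S = subst Odd (trans (solve 2 (λ s L → L :+ s :* con 2 := s :+ L :+ s) refl s L) (cong (_+ s) s+L≡r))
                  (odd+even odd-L (divides s refl))
    0<r : 0 < r
    0<r = pos-*ˡ (subst (0 <_) oddLeg (≤-trans 0<o (m≤m+n o (s * s))))
    0<L : 0 < L
    0<L = pos-*ˡ (subst (0 <_) o≡L[r+s] 0<o)
    0<S : 0 < S
    0<S = ≤-trans 0<r (m≤m+n r s)

    c-U-r : NoCommonPrime U r
    c-U-r = sumOfSquaresCoprime coprime hypot
    c-U-s : NoCommonPrime U s
    c-U-s = sumOfSquaresCoprime (ncp-sym coprime) (trans hypot (+-comm (r * r) (s * s)))
    c-U-L : NoCommonPrime U L
    c-U-L {g} pg g∣U g∣L = [ (λ g∣s → c-s-L pg g∣s g∣L) , (λ g∣r → c-r-L pg g∣r g∣L) ]′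
      (prime∣2rs pg odd-L g∣L (∣m+n∣m⇒∣n (subst (g ∣_) U≡L²+2sr g∣U) (∣m⇒∣m*n L g∣L)))
      where
      U≡L²+2sr : U ≡ L * L + s * r * 2
      U≡L²+2sr = trans hypot (trans (cong (λ z → z * z + s * s) (sym s+L≡r))
        (trans (solve 2 (λ s L → (s :+ L) :* (s :+ L) :+ s :* s := L :* L :+ s :* (s :+ L) :* con 2) refl s L)
               (cong (λ z → L * L + s * z * 2) s+L≡r)))
    c-U-S : NoCommonPrime U S
    c-U-S {g} pg g∣U g∣S = [ (λ g∣r → c-r-S pg g∣r g∣S) , (λ g∣s → c-s-S pg g∣s g∣S) ]′
      (prime∣2rs pg odd-S g∣S (∣m+n∣m⇒∣n (subst (g ∣_) S²≡U+2rs (∣m⇒∣m*n S g∣S)) g∣U))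
      where
      S²≡U+2rs : S * S ≡ U + r * s * 2
      S²≡U+2rs = trans (solve 2 (λ r s → (r :+ s) :* (r :+ s) := r :* r :+ s :* s :+ r :* s :* con 2) refl r s)
                       (cong (_+ r * s * 2) (sym hypot))
    p∤U : ¬ p ∣ U
    p∤U p∣U = coprime pp (p∣sumOfSquares r s (subst (p ∣_) hypot p∣U))
                         (p∣sumOfSquares s r (subst (p ∣_) (trans hypot (+-comm (r * r) (s * s))) p∣U))
    ncp-U² : ∀ {f} → NoCommonPrime U f → NoCommonPrime f (U * U)
    ncp-U² c = ncp-* (ncp-sym c) (ncp-sym c)

    -- Since o·e = 2·r·s·(r − s)·(r + s), the equation becomes r·s·L·S·U² = q·x⁴.
    product : r * s * L * S * (U * U) ≡ q * x ^ 4
    product = *-cancelˡ-≡ _ _ 2 (begin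
      2 * (r * s * L * S * (U * U))
        ≡⟨ solve 5 (λ r s L S U → con 2 :* (r :* s :* L :* S :* U) := L :* S :* (con 2 :* r :* s) :* U) refl r s L S (U * U) ⟩
      L * S * (2 * r * s) * (U * U)  ≡⟨ cong₂ (λ a b → a * b * (U * U)) (sym o≡L[r+s]) (sym evenLeg) ⟩
      o * e * (U * U)                ≡⟨ oeU²≡2qx⁴ ⟩
      2 * q * x ^ 4                  ≡⟨ *-assoc 2 q (x ^ 4) ⟩
      2 * (q * x ^ 4)                ∎)
      where open ≡-Reasoning

    cofactor : ∀ f a b c → r * s * L * S ≡ f * a * b * c → f * (a * b * c * (U * U)) ≡ q * x ^ 4
    cofactor f a b c e = trans (solve 5 (λ f a b c u → f :* (a :* b :* c :* u) := f :* a :* b :* c :* u) refl f a b c (U * U))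
                               (trans (cong (_* (U * U)) (sym e)) product)
    eq-r : r * (s * L * S * (U * U)) ≡ q * x ^ 4
    eq-r = cofactor r s L S refl
    eq-s : s * (r * L * S * (U * U)) ≡ q * x ^ 4
    eq-s = cofactor s r L S (solve 4 (λ r s L S → r :* s :* L :* S := s :* r :* L :* S) refl r s L S)
    eq-L : L * (r * s * S * (U * U)) ≡ q * x ^ 4
    eq-L = cofactor L r s S (solve 4 (λ r s L S → r :* s :* L :* S := L :* r :* s :* S) refl r s L S)
    eq-S : S * (r * s * L * (U * U)) ≡ q * x ^ 4
    eq-S = cofactor S r s L (solve 4 (λ r s L S → r :* s :* L :* S := S :* r :* s :* L) refl r s L S)
    c-r : NoCommonPrime r (s * L * S * (U * U))
    c-r = ncp-* (ncp-* (ncp-* coprime c-r-L) c-r-S) (ncp-U² c-U-r)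
    c-s : NoCommonPrime s (r * L * S * (U * U))
    c-s = ncp-* (ncp-* (ncp-* (ncp-sym coprime) c-s-L) c-s-S) (ncp-U² c-U-s)
    c-L : NoCommonPrime L (r * s * S * (U * U))
    c-L = ncp-* (ncp-* (ncp-* (ncp-sym c-r-L) (ncp-sym c-s-L)) c-L-S) (ncp-U² c-U-L)
    c-S : NoCommonPrime S (r * s * L * (U * U))
    c-S = ncp-* (ncp-* (ncp-* (ncp-sym c-r-S) (ncp-sym c-s-S)) (ncp-sym c-L-S)) (ncp-U² c-U-S)

    fourth : ∀ f M → 0 < f → f * M ≡ q * x ^ 4 → NoCommonPrime f M → ¬ p ∣ f → ∃[ F ] f ≡ F ^ 4
    fourth f M 0<f eq c p∤f = coprimeFactorIsPower 3 f M q x 0<f eq c (ncp-prime^ (suc k) pp p∤f)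
    qFourth : ∀ f M → 0 < f → f * M ≡ q * x ^ 4 → NoCommonPrime f M → ¬ p ∣ M → ∃[ F ] f ≡ q * F ^ 4
    qFourth f M 0<f eq c p∤M = coprimeFactorIsPrimePowerTimesPower 3 (suc k) f M x p pp 0<f eq c p∤M
    p∤cofactor : ∀ {a b c} → ¬ p ∣ a → ¬ p ∣ b → ¬ p ∣ c → ¬ p ∣ a * b * c * (U * U)
    p∤cofactor p∤a p∤b p∤c = prime∤* pp (prime∤* pp (prime∤* pp p∤a p∤b) p∤c) (prime∤* pp p∤U p∤U)

    -- p ∣ r + s: r = A⁴, s = B⁴, r − s = C⁴, so s + (r − s) = r gives B⁴ + C⁴ = A⁴.
    case-S : p ∣ S → ⊥
    case-S p∣S = finish (fourth r _ 0<r eq-r c-r (λ p∣r → c-r-S pp p∣r p∣S))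
                        (fourth s _ s>0 eq-s c-s (λ p∣s → c-s-S pp p∣s p∣S))
                        (fourth L _ 0<L eq-L c-L (λ p∣L → c-L-S pp p∣L p∣S))
      where
      finish : ∃[ A ] r ≡ A ^ 4 → ∃[ B ] s ≡ B ^ 4 → ∃[ C ] L ≡ C ^ 4 → ⊥
      finish (A , r≡A⁴) (B , s≡B⁴) (C , L≡C⁴) =
          fermatQuartic B C A (pos-^ 3 (subst (0 <_) s≡B⁴ s>0)) (pos-^ 3 (subst (0 <_) L≡C⁴ 0<L))
          (trans (sym (cong₂ _+_ s≡B⁴ L≡C⁴)) (trans s+L≡r r≡A⁴))

    -- p ∣ r − s: r = A⁴, s = B⁴, r + s = D⁴, so A⁴ + B⁴ = D⁴.
    case-L : p ∣ L → ⊥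
    case-L p∣L = finish (fourth r _ 0<r eq-r c-r (λ p∣r → c-r-L pp p∣r p∣L))
                        (fourth s _ s>0 eq-s c-s (λ p∣s → c-s-L pp p∣s p∣L))
                        (fourth S _ 0<S eq-S c-S (λ p∣S → c-L-S pp p∣L p∣S))
      where
      finish : ∃[ A ] r ≡ A ^ 4 → ∃[ B ] s ≡ B ^ 4 → ∃[ D ] S ≡ D ^ 4 → ⊥
      finish (A , r≡A⁴) (B , s≡B⁴) (D , S≡D⁴) =
        fermatQuartic A B D (pos-^ 3 (subst (0 <_) r≡A⁴ 0<r)) (pos-^ 3 (subst (0 <_) s≡B⁴ s>0))
          (trans (sym (cong₂ _+_ r≡A⁴ s≡B⁴)) S≡D⁴)

    -- p ∣ r: r = q·A⁴ while r − s = C⁴, r + s = D⁴, and C⁴ + D⁴ = 2q·A⁴.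
    case-r : p ∣ r → ⊥
    case-r p∣r = finish (qFourth r _ 0<r eq-r c-r (p∤cofactor p∤s p∤L p∤S))
                        (fourth L _ 0<L eq-L c-L p∤L) (fourth S _ 0<S eq-S c-S p∤S)
      where
      p∤s : ¬ p ∣ s
      p∤s p∣s = coprime pp p∣r p∣s
      p∤L : ¬ p ∣ L
      p∤L p∣L = c-r-L pp p∣r p∣L
      p∤S : ¬ p ∣ S
      p∤S p∣S = c-r-S pp p∣r p∣S
      finish : ∃[ A ] r ≡ q * A ^ 4 → ∃[ C ] L ≡ C ^ 4 → ∃[ D ] S ≡ D ^ 4 → ⊥
      finish (A , r≡qA⁴) (C , L≡C⁴) (D , S≡D⁴) = residue (fourthPowerResidue A)
        where
        C⁴+D⁴≡2qA⁴ : C ^ 4 + D ^ 4 ≡ 2 * q * A ^ 4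
        C⁴+D⁴≡2qA⁴ = begin
          C ^ 4 + D ^ 4        ≡⟨ sym (cong₂ _+_ L≡C⁴ S≡D⁴) ⟩
          L + (r + s)          ≡⟨ cong (λ z → L + (z + s)) (sym s+L≡r) ⟩
          L + (s + L + s)      ≡⟨ solve 2 (λ s L → L :+ (s :+ L :+ s) := con 2 :* (s :+ L)) refl s L ⟩
          2 * (s + L)          ≡⟨ cong (2 *_) (trans s+L≡r r≡qA⁴) ⟩
          2 * (q * A ^ 4)      ≡⟨ sym (*-assoc 2 q (A ^ 4)) ⟩
          2 * q * A ^ 4        ∎
          where open ≡-Reasoning
        -- L and S are odd, so C⁴ + D⁴ ≡ 2 (mod 16).
        2≋2qA⁴ : 2 ≋ 2 * q * A ^ 4 mod 16
        2≋2qA⁴ = mod-trans (mod-sym (mod-+ (oddFourthPower {C} (odd-fourthRoot (subst Odd L≡C⁴ odd-L)))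
                                           (oddFourthPower {D} (odd-fourthRoot (subst Odd S≡D⁴ odd-S)))))
                           (subst (λ w → C ^ 4 + D ^ 4 ≋ w mod 16) C⁴+D⁴≡2qA⁴ mod-refl)
        2q≋6 : 2 * q ≋ 6 mod 16
        2q≋6 = 0 , v , trans (+-identityʳ (2 * q))
          (trans (cong (2 *_) q≡3+8v) (solve 1 (λ v → con 2 :* (con 3 :+ v :* con 8) := con 6 :+ v :* con 16) refl v))
        2≋-impossible : ∀ {w} → 2 % 16 ≢ w % 16 → 2 ≋ w mod 16 → ⊥
        2≋-impossible 2≢w 2≋w = 2≢w (≋⇒%≡ 2≋w)
        residue : A ^ 4 ≋ 0 mod 16 ⊎ A ^ 4 ≋ 1 mod 16 → ⊥
        residue (inj₁ A⁴≡0) = 2≋-impossible {0} (λ ()) (mod-trans 2≋2qA⁴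
          (subst (λ w → 2 * q * A ^ 4 ≋ w mod 16) (*-zeroʳ (2 * q)) (mod-*ˡ (2 * q) A⁴≡0)))
        residue (inj₂ A⁴≡1) = 2≋-impossible {6} (λ ()) (mod-trans 2≋2qA⁴ (mod-trans
          (subst (λ w → 2 * q * A ^ 4 ≋ w mod 16) (*-identityʳ (2 * q)) (mod-*ˡ (2 * q) A⁴≡1)) 2q≋6))

    -- p ∣ s: s = q·B⁴ while r = A⁴, r − s = C⁴, r + s = D⁴, and r² = (r − s)(r + s) + s².
    case-s : p ∣ s → ⊥
    case-s p∣s = finish (fourth r _ 0<r eq-r c-r p∤r) (qFourth s _ s>0 eq-s c-s (p∤cofactor p∤r p∤L p∤S))
                        (fourth L _ 0<L eq-L c-L p∤L) (fourth S _ 0<S eq-S c-S p∤S)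
      where
      p∤r : ¬ p ∣ r
      p∤r p∣r = coprime pp p∣r p∣s
      p∤L : ¬ p ∣ L
      p∤L p∣L = c-s-L pp p∣s p∣L
      p∤S : ¬ p ∣ S
      p∤S p∣S = c-s-S pp p∣s p∣S
      finish : ∃[ A ] r ≡ A ^ 4 → ∃[ B ] s ≡ q * B ^ 4 → ∃[ C ] L ≡ C ^ 4 → ∃[ D ] S ≡ D ^ 4 → ⊥
      finish (A , r≡A⁴) (B , s≡qB⁴) (C , L≡C⁴) (D , S≡D⁴) =
        noQuarticSolution (A * A) (solution (C * D) β 0<CD (subst (0 <_) s≡qB⁴ s>0) A⁸≡[CD]⁴+β²)
        where
        β : ℕ
        β = q * B ^ 4
        0<CD : 0 < C * D
        0<CD = pos-* {C} {D} (pos-^ 3 (subst (0 <_) L≡C⁴ 0<L)) (pos-^ 3 (subst (0 <_) S≡D⁴ 0<S))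
        A⁸≡[CD]⁴+β² : (A * A) ^ 4 ≡ (C * D) ^ 4 + β * β
        A⁸≡[CD]⁴+β² = begin
          (A * A) ^ 4             ≡⟨ ^-distribʳ-* A A 4 ⟩
          A ^ 4 * A ^ 4           ≡⟨ cong₂ _*_ (sym r≡A⁴) (sym r≡A⁴) ⟩
          r * r                   ≡⟨ sym oddLeg ⟩
          o + s * s               ≡⟨ cong₂ (λ a b → a + b * b) o≡L[r+s] s≡qB⁴ ⟩
          L * S + β * β           ≡⟨ cong₂ (λ a b → a * b + β * β) L≡C⁴ S≡D⁴ ⟩
          C ^ 4 * D ^ 4 + β * β   ≡⟨ cong (_+ β * β) (sym (^-distribʳ-* C D 4)) ⟩
          (C * D) ^ 4 + β * β     ∎
          where open ≡-Reasoning

    whichFactor : p ∣ r * s * L * S * (U * U) → ⊥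
    whichFactor p∣P = fromProduct (euclidsLemma (r * s * L * S) (U * U) pp p∣P)
      where
      fromRS : p ∣ r ⊎ p ∣ s → ⊥
      fromRS (inj₁ p∣r) = case-r p∣r
      fromRS (inj₂ p∣s) = case-s p∣s
      fromRSL : p ∣ r * s ⊎ p ∣ L → ⊥
      fromRSL (inj₁ p∣rs) = fromRS (euclidsLemma r s pp p∣rs)
      fromRSL (inj₂ p∣L)  = case-L p∣L
      fromRSLS : p ∣ r * s * L ⊎ p ∣ S → ⊥
      fromRSLS (inj₁ p∣rsL) = fromRSL (euclidsLemma (r * s) L pp p∣rsL)
      fromRSLS (inj₂ p∣S)   = case-S p∣S
      fromProduct : p ∣ r * s * L * S ⊎ p ∣ U * U → ⊥
      fromProduct (inj₁ p∣rsLS) = fromRSLS (euclidsLemma (r * s * L) S pp p∣rsLS)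
      fromProduct (inj₂ p∣U²)   = p∤U (prime∣square U pp p∣U²)

    impossible : ⊥
    impossible = whichFactor (subst (p ∣_) (sym product) (∣m⇒∣m*n (x ^ 4) (m∣m*n (p ^ k))))

  noTripleSolution : ∀ k {v} o e U x → p ^ suc k ≡ 3 + v * 8 → Odd o → NoCommonPrime o e →
    0 < o → 0 < e → o * o + e * e ≡ U * U → o * e * (U * U) ≢ 2 * p ^ suc k * x ^ 4
  noTripleSolution k {v} o e U x q≡3+8v odd-o coe 0<o 0<e o²+e²≡U² oeU²≡2qx⁴ =
    CentralLemma.impossible k v o e U x q≡3+8v odd-o coe 0<o 0<e o²+e²≡U² oeU²≡2qx⁴

  -- There are no coprime m, n of opposite parity with m·n·(m² + n²) = 2q·x⁴:
  -- T = m² + n² is odd and prime to p (as p ∤ m), hence prime to 2q·mn, so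
  -- T = w⁴ and the triple m² + n² = (w²)² contradicts the central lemma.
  noOppositeParitySolution : ∀ k {v} m n x → p ^ suc k ≡ 3 + v * 8 → Odd m → 2 ∣ n →
    NoCommonPrime m n → 0 < m → 0 < n → m * n * (m * m + n * n) ≢ 2 * p ^ suc k * x ^ 4
  noOppositeParitySolution k {v} m n x q≡3+8v odd-m 2∣n cmn 0<m 0<n eq =
    noTripleSolution k {v} m n (w * w) x q≡3+8v odd-m cmn 0<m 0<n T≡[w²]² (trans (cong (m * n *_) (sym T≡[w²]²)) eq)
    where
    q : ℕ
    q = p ^ suc k
    T : ℕ
    T = m * m + n * n
    odd-T : Odd T
    odd-T = odd+even (odd*odd odd-m odd-m) (∣m⇒∣m*n n 2∣n)
    c-T-mn : NoCommonPrime T (m * n)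
    c-T-mn {g} pg g∣T g∣mn with euclidsLemma m n pg g∣mn
    ... | inj₁ g∣m = cmn pg g∣m (prime∣square n pg (∣m+n∣m⇒∣n g∣T (∣m⇒∣m*n m g∣m)))
    ... | inj₂ g∣n = cmn pg (prime∣square m pg (∣m+n∣m⇒∣n (subst (g ∣_) (+-comm (m * m) (n * n)) g∣T) (∣m⇒∣m*n n g∣n))) g∣n
    c-T-2q : NoCommonPrime T (2 * q)
    c-T-2q {g} pg g∣T g∣2q with euclidsLemma 2 q pg g∣2q
    ... | inj₁ g∣2 with prime∣prime⇒≡ pg prime[2] g∣2
    ...   | refl = odd⇒¬even odd-T g∣T
    c-T-2q {g} pg g∣T g∣2q | inj₂ g∣q with prime∣prime⇒≡ pg pp (prime∣^ p (suc k) pg g∣q)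
    ... | refl = cmn pp (p∣sumOfSquares m n g∣T) (p∣sumOfSquares n m (subst (p ∣_) (+-comm (m * m) (n * n)) g∣T))
    fourthRoot : ∃[ w ] T ≡ w ^ 4
    fourthRoot = coprimeFactorIsPower 3 T (m * n) (2 * q) x (≤-trans (pos-* 0<m 0<m) (m≤m+n _ _))
                   (trans (*-comm T (m * n)) eq) c-T-mn c-T-2q
    w : ℕ
    w = proj₁ fourthRoot
    T≡[w²]² : m * m + n * n ≡ w * w * (w * w)
    T≡[w²]² = trans (proj₂ fourthRoot) (^4≡square² w)

  -- For odd coprime y, z, write z = y + 2n and m = y + n (so m, n are coprime
  -- of opposite parity); then z⁴ − y⁴ = 8·m·n·(m² + n²), and
  -- z⁴ = y⁴ + 16q·x⁴ becomes m·n·(m² + n²) = 2q·x⁴.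
  noSolution-oddYZ : ∀ k {v} x y z → p ^ suc k ≡ 3 + v * 8 → 0 < x → NoCommonPrime y z →
    Odd y → Odd z → z ^ 4 ≢ y ^ 4 + p ^ suc k * x ^ 4 * 16
  noSolution-oddYZ k {v} x y z q≡3+8v 0<x cyz odd-y odd-z eq = byParity (parity m) (parity n)
    where
    K : ℕ
    K = p ^ suc k * x ^ 4
    y<z : y < z
    y<z = fourthPower-cancel-< (subst (y ^ 4 <_) (sym eq) (m<m+n (y ^ 4) (pos-* (pos-* (m^n>0 p {{prime⇒nonZero pp}} (suc k)) (m^n>0 x {{>-nonZero 0<x}} 4)) (s≤s z≤n))))
    y+d≡z : y + (z ∸ y) ≡ z
    y+d≡z = m+[n∸m]≡n (<⇒≤ y<z)
    n : ℕ
    n = _∣_.quotient (even-difference odd-y odd-z y+d≡z)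
    d≡2n : z ∸ y ≡ n * 2
    d≡2n = _∣_.equality (even-difference odd-y odd-z y+d≡z)
    m : ℕ
    m = y + n
    z≡y+2n : z ≡ y + n * 2
    z≡y+2n = trans (sym y+d≡z) (cong (y +_) d≡2n)
    0<n : 0 < n
    0<n = pos-*ˡ (subst (0 <_) d≡2n (m<n⇒0<n∸m y<z))
    0<m : 0 < m
    0<m = ≤-trans 0<n (m≤n+m n y)
    mnT≡2qx⁴ : m * n * (m * m + n * n) ≡ 2 * p ^ suc k * x ^ 4
    mnT≡2qx⁴ = *-cancelʳ-≡ _ _ 8 (+-cancelˡ-≡ (y ^ 4) _ _ (begin
      y ^ 4 + (y + n) * n * ((y + n) * (y + n) + n * n) * 8
        ≡⟨ solve 2 (λ y n → y :^ 4 :+ (y :+ n) :* n :* ((y :+ n) :* (y :+ n) :+ n :* n) :* con 8 := (y :+ n :* con 2) :^ 4) refl y n ⟩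
      (y + n * 2) ^ 4          ≡⟨ cong (_^ 4) (sym z≡y+2n) ⟩
      z ^ 4                    ≡⟨ eq ⟩
      y ^ 4 + K * 16           ≡⟨ cong (y ^ 4 +_) (solve 2 (λ q x → q :* x :* con 16 := con 2 :* q :* x :* con 8) refl (p ^ suc k) (x ^ 4)) ⟩
      y ^ 4 + 2 * p ^ suc k * x ^ 4 * 8 ∎))
      where open ≡-Reasoning
    cmn : NoCommonPrime m n
    cmn {g} pg g∣m g∣n = cyz pg g∣y (subst (g ∣_) (sym z≡y+2n) (∣m∣n⇒∣m+n g∣y (∣m⇒∣m*n 2 g∣n)))
      where
      g∣y : g ∣ y
      g∣y = ∣m+n∣m⇒∣n (subst (g ∣_) (+-comm y n) g∣m) g∣n
    byParity : 2 ∣ m ⊎ Odd m → 2 ∣ n ⊎ Odd n → ⊥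
    byParity (inj₁ 2∣m)  (inj₁ 2∣n)  = cmn prime[2] 2∣m 2∣n
    byParity (inj₂ odd-m) (inj₂ odd-n) = odd⇒¬even odd-m (odd+odd odd-y odd-n)
    byParity (inj₂ odd-m) (inj₁ 2∣n)  = noOppositeParitySolution k {v} m n x q≡3+8v odd-m 2∣n cmn 0<m 0<n mnT≡2qx⁴
    byParity (inj₁ 2∣m)  (inj₂ odd-n) = noOppositeParitySolution k {v} n m x q≡3+8v odd-n 2∣m (ncp-sym cmn) 0<n 0<m
      (trans (solve 2 (λ m n → n :* m :* (n :* n :+ m :* m) := m :* n :* (m :* m :+ n :* n)) refl m n) mnT≡2qx⁴)

  -- For odd x see
  -- noSolution-oddX; for x = 2x′ the right side is y⁴ + 16q·x′⁴, which rules
  -- out y, z of different parity modulo 16.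
  noSolution-q : ∀ k {v} x y z → p ^ suc k ≡ 3 + v * 8 → 0 < x → NoCommonPrime y z →
    z ^ 4 ≢ y ^ 4 + p ^ suc k * x ^ 4
  noSolution-q k {v} x y z q≡3+8v 0<x cyz eq with parity x
  ... | inj₂ odd-x = noSolution-oddX {v = v} x y z q≡3+8v odd-x eq
  ... | inj₁ (divides x′ refl) = byParity (parity y) (parity z)
    where
    eq16 : z ^ 4 ≡ y ^ 4 + p ^ suc k * x′ ^ 4 * 16
    eq16 = trans eq (cong (y ^ 4 +_) (solve 2 (λ q x → q :* (x :* con 2) :^ 4 := q :* x :^ 4 :* con 16) refl (p ^ suc k) x′))
    z⁴≋y⁴ : z ^ 4 ≋ y ^ 4 mod 16
    z⁴≋y⁴ = 0 , p ^ suc k * x′ ^ 4 , trans (+-identityʳ _) eq16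
    byParity : 2 ∣ y ⊎ Odd y → 2 ∣ z ⊎ Odd z → ⊥
    byParity (inj₁ 2∣y)  (inj₁ 2∣z)  = cyz prime[2] 2∣y 2∣z
    byParity (inj₁ 2∣y)  (inj₂ odd-z) =
      contradiction (≋⇒%≡ (mod-trans (mod-sym (oddFourthPower odd-z)) (mod-trans z⁴≋y⁴ (evenFourthPower 2∣y)))) λ ()
    byParity (inj₂ odd-y) (inj₁ 2∣z)  =
      contradiction (≋⇒%≡ (mod-trans (mod-sym (evenFourthPower 2∣z)) (mod-trans z⁴≋y⁴ (oddFourthPower odd-y)))) λ ()
    byParity (inj₂ odd-y) (inj₂ odd-z) =
      noSolution-oddYZ k {v} x′ y z q≡3+8v (pos-*ˡ 0<x) cyz odd-y odd-z eq16

  -- With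
  -- j = 4i + r and W = p^i·X this reads p^r·W⁴ + y⁴ = z⁴, which is Fermat's
  -- equation (r = 0), z⁴ − y⁴ = (pW²)² (r = 2), or the q-equation with
  -- q = p (r = 1) or q = p³ ≡ 3 (mod 8) (r = 3).
  noSolution-pʲ : ∀ j X y z → 0 < X → 0 < y → NoCommonPrime y z → p ^ j * X ^ 4 + y ^ 4 ≢ z ^ 4
  noSolution-pʲ j X y z 0<X 0<y cyz eq = byResidue (j % 4) (m%n<n j 4) (m≡m%n+[m/n]*n j 4)
    where
    instance _ = prime⇒nonZero pp
    W : ℕ
    W = p ^ (j / 4) * X
    0<W : 0 < W
    0<W = pos-* (m^n>0 p (j / 4)) 0<X
    equation : ∀ r → j ≡ r + j / 4 * 4 → z ^ 4 ≡ y ^ 4 + p ^ r * W ^ 4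
    equation r j≡r+4i = begin
      z ^ 4                                   ≡⟨ sym eq ⟩
      p ^ j * X ^ 4 + y ^ 4                   ≡⟨ +-comm _ (y ^ 4) ⟩
      y ^ 4 + p ^ j * X ^ 4                   ≡⟨ cong (λ e → y ^ 4 + p ^ e * X ^ 4) j≡r+4i ⟩
      y ^ 4 + p ^ (r + i * 4) * X ^ 4         ≡⟨ cong (λ e → y ^ 4 + e * X ^ 4) (^-distribˡ-+-* p r (i * 4)) ⟩
      y ^ 4 + p ^ r * p ^ (i * 4) * X ^ 4     ≡⟨ cong (λ e → y ^ 4 + p ^ r * e * X ^ 4) (sym (^-*-assoc p i 4)) ⟩
      y ^ 4 + p ^ r * (p ^ i) ^ 4 * X ^ 4     ≡⟨ cong (y ^ 4 +_) (trans (*-assoc (p ^ r) _ _) (cong (p ^ r *_) (sym (^-distribʳ-* (p ^ i) X 4)))) ⟩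
      y ^ 4 + p ^ r * W ^ 4                   ∎
      where
      open ≡-Reasoning
      i : ℕ
      i = j / 4
    byResidue : ∀ r → r < 4 → j ≡ r + j / 4 * 4 → ⊥
    byResidue 0 _ j≡4i = fermatQuartic W y z 0<W 0<y
      (trans (+-comm (W ^ 4) (y ^ 4)) (sym (trans (equation 0 j≡4i) (cong (y ^ 4 +_) (*-identityˡ (W ^ 4))))))
    byResidue 1 _ j≡1+4i = noSolution-q 0 {u} W y z (trans (*-identityʳ p) p≡3+8u) 0<W cyz (equation 1 j≡1+4i)
    byResidue 2 _ j≡2+4i = noQuarticSolution z (solution y (p * (W * W)) 0<y (pos-* (≤-trans (s≤s z≤n) (prime≥2 pp)) (pos-* 0<W 0<W))
      (trans (equation 2 j≡2+4i) (cong (y ^ 4 +_)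
        (solve 2 (λ p w → p :^ 2 :* w :^ 4 := p :* (w :* w) :* (p :* (w :* w))) refl p W))))
    byResidue 3 _ j≡3+4i = noSolution-q 2 {3 + 27 * u + 72 * u * u + 64 * u * u * u} W y z p³≡3+8v 0<W cyz (equation 3 j≡3+4i)
      where
      p³≡3+8v : p ^ 3 ≡ 3 + (3 + 27 * u + 72 * u * u + 64 * u * u * u) * 8
      p³≡3+8v = trans (cong (_^ 3) p≡3+8u)
        (solve 1 (λ u → (con 3 :+ u :* con 8) :^ 3 := con 3 :+ (con 3 :+ con 27 :* u :+ con 72 :* u :* u :+ con 64 :* u :* u :* u) :* con 8) refl u)
    byResidue (suc (suc (suc (suc _)))) (s≤s (s≤s (s≤s (s≤s ())))) _

  fourthPowerFactor : ∀ {f} K M D → 0 < f → ¬ p ∣ f → NoCommonPrime f M → f * (M * p ^ K) ≡ D ^ 4 →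
    ∃[ F ] f ≡ F ^ 4
  fourthPowerFactor K M D 0<f p∤f cfM eq = coprimeFactorOfFourthPower D 0<f eq (ncp-* cfM (ncp-prime^ K pp p∤f))

  -- The case p ∣ a: then p ∤ b, c, so a = p^j·X⁴, b = y⁴, c = z⁴.
  noSolution-p∣a : ∀ K a b c D → 0 < a → 0 < b → 0 < c → NoCommonPrime a b → p ∣ a →
    a + b ≡ c → a * b * c * p ^ K ≢ D ^ 4
  noSolution-p∣a K a b c D 0<a 0<b 0<c cab p∣a a+b≡c eq with splitPrimePower p a pp 0<a
  ... | j , a′ , a≡pʲa′ , p∤a′ =
    noSolution-pʲ j X y z (pos-^ 3 (subst (0 <_) a′≡X⁴ 0<a′)) (pos-^ 3 (subst (0 <_) b≡y⁴ 0<b))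
      (ncp-∣ʳ (divides (z ^ 3) (trans c≡z⁴ (*-comm z (z ^ 3))))
        (ncp-∣ˡ (divides (y ^ 3) (trans b≡y⁴ (*-comm y (y ^ 3)))) cbc))
      (begin
        p ^ j * X ^ 4 + y ^ 4   ≡⟨ cong₂ (λ x w → p ^ j * x + w) (sym a′≡X⁴) (sym b≡y⁴) ⟩
        p ^ j * a′ + b          ≡⟨ cong (_+ b) (sym a≡pʲa′) ⟩
        a + b                   ≡⟨ a+b≡c ⟩
        c                       ≡⟨ c≡z⁴ ⟩
        z ^ 4                   ∎)
    where
    open ≡-Reasoning
    cac : NoCommonPrime a c
    cac = sum-coprimeˡ cab a+b≡c
    cbc : NoCommonPrime b c
    cbc = sum-coprimeʳ cab a+b≡c
    a′∣a : a′ ∣ a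
    a′∣a = divides (p ^ j) a≡pʲa′
    0<a′ : 0 < a′
    0<a′ = pos-∣ 0<a a′∣a
    fourthRoot-a′ : ∃[ X ] a′ ≡ X ^ 4
    fourthRoot-a′ = fourthPowerFactor K (p ^ j * b * c) D 0<a′ p∤a′
      (ncp-* (ncp-* (ncp-prime^ j pp p∤a′) (ncp-∣ˡ a′∣a cab)) (ncp-∣ˡ a′∣a cac))
      (trans (solve 5 (λ a x b c y → a :* (x :* b :* c :* y) := x :* a :* b :* c :* y) refl a′ (p ^ j) b c (p ^ K))
             (trans (cong (λ w → w * b * c * p ^ K) (sym a≡pʲa′)) eq))
    fourthRoot-b : ∃[ y ] b ≡ y ^ 4
    fourthRoot-b = fourthPowerFactor K (a * c) D 0<b (λ p∣b → cab pp p∣a p∣b) (ncp-* (ncp-sym cab) cbc)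
      (trans (solve 4 (λ a b c y → b :* (a :* c :* y) := a :* b :* c :* y) refl a b c (p ^ K)) eq)
    fourthRoot-c : ∃[ z ] c ≡ z ^ 4
    fourthRoot-c = fourthPowerFactor K (a * b) D 0<c (λ p∣c → cac pp p∣a p∣c) (ncp-* (ncp-sym cac) (ncp-sym cbc))
      (trans (solve 4 (λ a b c y → c :* (a :* b :* y) := a :* b :* c :* y) refl a b c (p ^ K)) eq)
    X : ℕ
    X = proj₁ fourthRoot-a′
    y : ℕ
    y = proj₁ fourthRoot-b
    z : ℕ
    z = proj₁ fourthRoot-c
    a′≡X⁴ : a′ ≡ X ^ 4
    a′≡X⁴ = proj₂ fourthRoot-a′
    b≡y⁴ : b ≡ y ^ 4
    b≡y⁴ = proj₂ fourthRoot-b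
    c≡z⁴ : c ≡ z ^ 4
    c≡z⁴ = proj₂ fourthRoot-c

  -- The case p ∤ a, b: then a = x⁴ and b = y⁴.  If p ∣ c then p divides the
  -- sum of squares (x²)² + (y²)², hence x; otherwise c = z⁴ and x⁴ + y⁴ = z⁴.
  noSolution-p∤ab : ∀ K a b c D → 0 < a → 0 < b → 0 < c → NoCommonPrime a b → ¬ p ∣ a → ¬ p ∣ b →
    a + b ≡ c → a * b * c * p ^ K ≢ D ^ 4
  noSolution-p∤ab K a b c D 0<a 0<b 0<c cab p∤a p∤b a+b≡c eq = byDivisibility (p ∣? c)
    where
    cac : NoCommonPrime a c
    cac = sum-coprimeˡ cab a+b≡c
    cbc : NoCommonPrime b c
    cbc = sum-coprimeʳ cab a+b≡c
    fourthRoot-a : ∃[ x ] a ≡ x ^ 4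
    fourthRoot-a = fourthPowerFactor K (b * c) D 0<a p∤a (ncp-* cab cac)
      (trans (solve 4 (λ a b c y → a :* (b :* c :* y) := a :* b :* c :* y) refl a b c (p ^ K)) eq)
    fourthRoot-b : ∃[ y ] b ≡ y ^ 4
    fourthRoot-b = fourthPowerFactor K (a * c) D 0<b p∤b (ncp-* (ncp-sym cab) cbc)
      (trans (solve 4 (λ a b c y → b :* (a :* c :* y) := a :* b :* c :* y) refl a b c (p ^ K)) eq)
    x : ℕ
    x = proj₁ fourthRoot-a
    y : ℕ
    y = proj₁ fourthRoot-b
    a≡x⁴ : a ≡ x ^ 4
    a≡x⁴ = proj₂ fourthRoot-a
    b≡y⁴ : b ≡ y ^ 4
    b≡y⁴ = proj₂ fourthRoot-b
    byDivisibility : Dec (p ∣ c) → ⊥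
    byDivisibility (yes p∣c) = p∤a (subst (p ∣_) (sym a≡x⁴) (∣m⇒∣m*n (x ^ 3) (prime∣square x pp
      (p∣sumOfSquares (x * x) (y * y) (subst (p ∣_) c≡x⁴+y⁴ p∣c)))))
      where
      c≡x⁴+y⁴ : c ≡ x * x * (x * x) + y * y * (y * y)
      c≡x⁴+y⁴ = trans (sym a+b≡c) (cong₂ _+_ (trans a≡x⁴ (^4≡square² x)) (trans b≡y⁴ (^4≡square² y)))
    byDivisibility (no p∤c) with fourthPowerFactor K (a * b) D 0<c p∤c (ncp-* (ncp-sym cac) (ncp-sym cbc))
                                   (trans (solve 4 (λ a b c y → c :* (a :* b :* y) := a :* b :* c :* y) refl a b c (p ^ K)) eq)
    ... | z , c≡z⁴ = fermatQuartic x y z (pos-^ 3 (subst (0 <_) a≡x⁴ 0<a)) (pos-^ 3 (subst (0 <_) b≡y⁴ 0<b))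
                       (trans (cong₂ _+_ (sym a≡x⁴) (sym b≡y⁴)) (trans a+b≡c c≡z⁴))

  noCoprimeSolution : ∀ K a b c D → 0 < a → 0 < b → 0 < c → NoCommonPrime a b →
    a + b ≡ c → a * b * c * p ^ K ≢ D ^ 4
  noCoprimeSolution K a b c D 0<a 0<b 0<c cab a+b≡c eq with p ∣? a | p ∣? b
  ... | yes p∣a | _       = noSolution-p∣a K a b c D 0<a 0<b 0<c cab p∣a a+b≡c eq
  ... | no p∤a  | yes p∣b = noSolution-p∣a K b a c D 0<b 0<a 0<c (ncp-sym cab) p∣b
                              (trans (+-comm b a) a+b≡c) (trans (cong (λ w → w * c * p ^ K) (*-comm b a)) eq)
  ... | no p∤a  | no p∤b  = noSolution-p∤ab K a b c D 0<a 0<b 0<c cab p∤a p∤b a+b≡c eq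

record GcdReduction (A B C : ℕ) : Set where
  field
    a b c   : ℕ
    A≡aG    : A ≡ a * gcd (gcd A B) C
    B≡bG    : B ≡ b * gcd (gcd A B) C
    C≡cG    : C ≡ c * gcd (gcd A B) C
    a+b≡c   : a + b ≡ c
    coprime : NoCommonPrime a b

reduceByGcd : ∀ A B C → 0 < gcd (gcd A B) C → A + B ≡ C → GcdReduction A B C
reduceByGcd A B C 0<G A+B≡C = record
  { a = a ; b = b ; c = c ; A≡aG = A≡aG ; B≡bG = B≡bG ; C≡cG = C≡cG ; a+b≡c = a+b≡c ; coprime = cab }
  where
  G : ℕ
  G = gcd (gcd A B) C
  instance _ = >-nonZero 0<G
  open _∣_ (∣-trans (gcd[m,n]∣m (gcd A B) C) (gcd[m,n]∣m A B)) renaming (quotient to a; equality to A≡aG)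
  open _∣_ (∣-trans (gcd[m,n]∣m (gcd A B) C) (gcd[m,n]∣n A B)) renaming (quotient to b; equality to B≡bG)
  open _∣_ (gcd[m,n]∣n (gcd A B) C) renaming (quotient to c; equality to C≡cG)
  a+b≡c : a + b ≡ c
  a+b≡c = *-cancelʳ-≡ _ _ G (trans (*-distribʳ-+ G a b) (trans (cong₂ _+_ (sym A≡aG) (sym B≡bG)) (trans A+B≡C C≡cG)))
  -- A common prime g of a and b would make gG a common divisor of A, B, C.
  cab : NoCommonPrime a b
  cab {g} pg g∣a g∣b = prime∤1 pg (*-cancelʳ-∣ G (subst (g * G ∣_) (sym (*-identityˡ G)) gG∣G))
    where
    g∣c : g ∣ c
    g∣c = subst (g ∣_) a+b≡c (∣m∣n⇒∣m+n g∣a g∣b)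
    gG∣G : g * G ∣ G
    gG∣G = gcd-greatest (gcd-greatest (subst (g * G ∣_) (sym A≡aG) (*-monoˡ-∣ G g∣a))
                                      (subst (g * G ∣_) (sym B≡bG) (*-monoˡ-∣ G g∣b)))
                        (subst (g * G ∣_) (sym C≡cG) (*-monoˡ-∣ G g∣c))

theorem3 : (p k : ℕ) → Prime p → p % 8 ≡ 3 → 0 < k →
    ¬ (∃[ A ] ∃[ B ] ∃[ C ] ∃[ D ]
         (0 < A × 0 < B × 0 < C × 0 < D ×
          gcd (gcd A B) C ≡ p ^ k × A + B ≡ C × A * B * C ≡ D ^ 4))
theorem3 p k pp p%8≡3 _ (A , B , C , D , 0<A , 0<B , 0<C , _ , G≡pᵏ , A+B≡C , ABC≡D⁴) =
  noCoprimeSolution {u = p / 8} pp p≡3+8u (k * 3) a b c D (pos-*ˡ (subst (0 <_) A≡aG 0<A))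
    (pos-*ˡ (subst (0 <_) B≡bG 0<B)) (pos-*ˡ (subst (0 <_) C≡cG 0<C)) coprime a+b≡c abcp³ᵏ≡D⁴
  where
  instance _ = prime⇒nonZero pp
  G : ℕ
  G = gcd (gcd A B) C
  open GcdReduction (reduceByGcd A B C (subst (0 <_) (sym G≡pᵏ) (m^n>0 p k)) A+B≡C)
  p≡3+8u : p ≡ 3 + p / 8 * 8
  p≡3+8u = trans (m≡m%n+[m/n]*n p 8) (cong (_+ p / 8 * 8) p%8≡3)
  abcp³ᵏ≡D⁴ : a * b * c * p ^ (k * 3) ≡ D ^ 4
  abcp³ᵏ≡D⁴ = begin
    a * b * c * p ^ (k * 3)       ≡⟨ cong (a * b * c *_) (trans (sym (^-*-assoc p k 3)) (cong (_^ 3) (sym G≡pᵏ))) ⟩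
    a * b * c * G ^ 3             ≡⟨ solve 4 (λ a b c g → a :* b :* c :* g :^ 3 := a :* g :* (b :* g) :* (c :* g)) refl a b c G ⟩
    a * G * (b * G) * (c * G)     ≡⟨ cong₂ (λ x y → x * y * (c * G)) (sym A≡aG) (sym B≡bG) ⟩
    A * B * (c * G)               ≡⟨ cong (A * B *_) (sym C≡cG) ⟩
    A * B * C                     ≡⟨ ABC≡D⁴ ⟩
    D ^ 4                         ∎
    where open ≡-Reasoning
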